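{- Let $(\mathfrak{M}_X,m)$ be an arithmetic matroid on a finite list $X$ with no proper vectors, and let $v\in X$ be a free vector. Then $\overline{M}_X(x,y)=(x-1)\overline{M}_{X_1}(x,y)+\overline{M}_{X_2}(x,y)$, where $\overline M_{X_1}$, $\overline M_{X_2}$ are the polynomials $\overline M$ of the deletion and of the contraction of $v$ (which again have no proper vectors).
   Context: A matroid on a list $X$ (finite multiset) is given by a rank function $rk$; bases are sublists $B$ with $|B|=rk(B)=rk(X)$; dual rank $rk^*(A)=|A|-rk(X)+rk(X\setminus A)$, dual bases are $B^c=X\setminus B$. An arithmetic matroid has a multiplicity $m$ from sublists to positive integers satisfying: (1) $rk(A\cup\{v\})=rk(A)$ implies $m(A\cup\{v\})\mid m(A)$; (2) $rk(A\cup\{v\})=rk(A)+1$ implies $m(A)\mid m(A\cup\{v\})$; (3) if $A\subseteq B$, $B=A\sqcup F\sqcup T$ and $rk(C)=rk(A)+|C\cap F|$ for all $A\subseteq C\subseteq B$, then $m(A)m(B)=m(A\cup F)m(A\cup T)$; (4) $\sum_{A\subseteq T\subseteq B}(-1)^{|T|-|A|}m(T)\ge0$ when $rk(A)=rk(B)$; (5) $\sum_{A\subseteq T\subseteq B}(-1)^{|T|-|A|}m(X\setminus T)\ge0$ when $rk^*(A)=rk^*(B)$. Deletion of $v$: $X_1=X\setminus\{v\}$ with $rk,m$ restricted. Contraction: $X_2=X\setminus\{v\}$ with $rk_2(A)=rk(A\cup\{v\})-rk(\{v\})$, $m_2(A)=m(A\cup\{v\})$. $v$ is free if $rk(X\setminus\{v\})=rk_2(X\setminus\{v\})=rk(X)-1$,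 torsion if $rk(X\setminus\{v\})=rk_2(X\setminus\{v\})=rk(X)$, proper if $rk(X\setminus\{v\})=rk(X)$ and $rk_2(X\setminus\{v\})=rk(X)-1$. With no proper vectors, the matroid has a unique basis $B$ (the free vectors). For $S$ with $rk(S)=rk(X)$, $\mu(S)=\sum_{S\subseteq T\subseteq X}(-1)^{|T|-|S|}m(T)$; for $S$ with $rk^*(S)=rk^*(X)$, $\mu^*(S)=\sum_{S\subseteq T\subseteq X}(-1)^{|T|-|S|}m(X\setminus T)$. $\mathcal{B}$ is the list of pairs $(B,T)$, $B\subseteq T\subseteq X$, each appearing $\mu(T)$ times; $\mathcal{B}^*$ the list of pairs $(B^c,\widetilde T)$, $B^c\subseteq\widetilde T\subseteq X$, each appearing $\mu^*(\widetilde T)$ times. $e(B,T)$ is the number of elements of $T\setminus B$ externally active on $B$ and $e^*(B^c,\widetilde T)$ the number of elements of $\widetilde T\setminus B^c$ externally active on $B^c$ in the dual (here every element of $T\setminus B$, resp. $\widetilde T\setminus B^c$, is active, so $e(B,T)=|T\setminus B|$ and $e^*(B^c,\widetilde T)=|\widetilde T\setminus B^c|$). An equidistributed bijection $\psi:\mathcal{B}\to\mathcal{B}^*$ is one sending, for all $T,\widetilde T$, exactly $\mu(T)\mu^*(\widetilde T)/m(B)$ copies of $(B,T)$ to copies of $(B^c,\widetilde T)$; such $\psi$ exists, and $\overline M_X(x,y)=\sum_{(B^c,\widetilde T)\in\mathcal{B}^*}x^{e^*(B^c,\widetilde T)}y^{e(\psi^{ -1}(B^c,\widetilde T))}$, which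 does not depend on the choice of $\psi$. -}

module Defs where

open import Data.Nat as ℕ using (ℕ; zero; suc; _∸_; _<_; _≤_)
open import Data.Nat.Divisibility using (_∣_)
open import Data.Integer as ℤ using (ℤ; +_; ∣_∣)
open import Data.Bool as Bool using (Bool; true; false)
open import Data.Fin using (Fin)
open import Data.Fin.Subset using (Subset; _⊆_; _∪_; _∩_; ⁅_⁆; ∁; ⊤; ⊥; _─_)
  renaming (∣_∣ to #_)
open import Data.Fin.Subset.Properties using (_⊆?_)
open import Data.Vec as Vec using (Vec; []; _∷_; insertAt)
import Data.Vec.Properties as VecP
import Data.Product.Properties as ProdP
open import Data.List as List using (List; []; _∷_; _++_; map; filter; concatMap; replicate; length; lookup; allFin; foldr)
open import Data.Product using (Σ; _×_; _,_; proj₁; proj₂)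
open import Relation.Binary.PropositionalEquality using (_≡_)
open import Relation.Binary.Definitions using (DecidableEquality)
open import Relation.Nullary using (¬_; Dec; _×-dec_)
open import Function.Bundles using (_↔_; Inverse)

-- Finite combinatorics on sublists of X = [x_0, …, x_{n-1}].
-- A sublist of X is identified with the set of its positions: Subset n.

allSubsets : ∀ n → List (Subset n)
allSubsets zero    = [] ∷ []
allSubsets (suc n) = map (false ∷_) (allSubsets n) ++ map (true ∷_) (allSubsets n)

sgn : ℕ → ℤ
sgn zero    = + 1
sgn (suc k) = ℤ.- sgn k

sumℤ : List ℤ → ℤ
sumℤ = foldr ℤ._+_ (+ 0)

count : ∀ {A : Set} {P : A → Set} → ((a : A) → Dec (P a)) → List A → ℕ
count P? xs = length (filter P? xs)

intervalSum : ∀ {n} → Subset n → Subset n → (Subset n → ℤ) → ℤ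
intervalSum {n} A B f =
  sumℤ (map f (filter (λ T → (A ⊆? T) ×-dec (T ⊆? B)) (allSubsets n)))

dualRank : ∀ {n} → (Subset n → ℕ) → Subset n → ℤ
dualRank rk A = (+ (# A) ℤ.- + (rk ⊤)) ℤ.+ + (rk (∁ A))

record ArithMatroid (n : ℕ) : Set where
  field
    rk : Subset n → ℕ
    m  : Subset n → ℕ
    rk-bound   : ∀ A → rk A ≤ # A
    rk-mono    : ∀ A B → A ⊆ B → rk A ≤ rk B
    rk-submod  : ∀ A B → rk (A ∪ B) ℕ.+ rk (A ∩ B) ≤ rk A ℕ.+ rk B
    m-pos      : ∀ A → 0 < m A
    ax1 : ∀ A v → rk (A ∪ ⁅ v ⁆) ≡ rk A → m (A ∪ ⁅ v ⁆) ∣ m A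
    ax2 : ∀ A v → rk (A ∪ ⁅ v ⁆) ≡ suc (rk A) → m A ∣ m (A ∪ ⁅ v ⁆)
    ax3 : ∀ A F T → A ∩ F ≡ ⊥ → A ∩ T ≡ ⊥ → F ∩ T ≡ ⊥ →
          (∀ C → A ⊆ C → C ⊆ (A ∪ F) ∪ T → rk C ≡ rk A ℕ.+ # (C ∩ F)) →
          m A ℕ.* m ((A ∪ F) ∪ T) ≡ m (A ∪ F) ℕ.* m (A ∪ T)
    ax4 : ∀ A B → A ⊆ B → rk A ≡ rk B →
          + 0 ℤ.≤ intervalSum A B (λ T → sgn (# T ∸ # A) ℤ.* + (m T))
    ax5 : ∀ A B → A ⊆ B → dualRank rk A ≡ dualRank rk B →
          + 0 ℤ.≤ intervalSum A B (λ T → sgn (# T ∸ # A) ℤ.* + (m (∁ T)))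

delRk delM : ∀ {n} → (Subset (suc n) → ℕ) → Fin (suc n) → Subset n → ℕ
delRk rk v A = rk (insertAt A v false)
delM  m  v A = m  (insertAt A v false)

conRk : ∀ {n} → (Subset (suc n) → ℕ) → Fin (suc n) → Subset n → ℕ
conRk rk v A = rk (insertAt A v true) ∸ rk ⁅ v ⁆

conM : ∀ {n} → (Subset (suc n) → ℕ) → Fin (suc n) → Subset n → ℕ
conM m v A = m (insertAt A v true)

-- Free / torsion / proper vectors.
-- Here X \ {v} = ∁ ⁅ v ⁆, rk(X \ {v}) = rk (∁ ⁅ v ⁆) and
-- rk₂(X \ {v}) = rk(X) - rk({v}).

Free : ∀ {n} → (Subset n → ℕ) → Fin n → Set
Free rk v = suc (rk (∁ ⁅ v ⁆)) ≡ rk ⊤ × suc (rk ⊤ ∸ rk ⁅ v ⁆) ≡ rk ⊤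

Torsion : ∀ {n} → (Subset n → ℕ) → Fin n → Set
Torsion rk v = rk (∁ ⁅ v ⁆) ≡ rk ⊤ × rk ⊤ ∸ rk ⁅ v ⁆ ≡ rk ⊤

Proper : ∀ {n} → (Subset n → ℕ) → Fin n → Set
Proper rk v = rk (∁ ⁅ v ⁆) ≡ rk ⊤ × suc (rk ⊤ ∸ rk ⁅ v ⁆) ≡ rk ⊤

NoProper : ∀ {n} → (Subset n → ℕ) → Set
NoProper {n} rk = ∀ (v : Fin n) → ¬ Proper rk v

module _ {n : ℕ} (rk m : Subset n → ℕ) where

  IsBasis : Subset n → Set
  IsBasis B = # B ≡ rk B × rk B ≡ rk ⊤

  isBasis? : ∀ B → Dec (IsBasis B)
  isBasis? B = (# B ℕ.≟ rk B) ×-dec (rk B ℕ.≟ rk ⊤)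

  μ : Subset n → ℤ
  μ S = intervalSum S ⊤ (λ T → sgn (# T ∸ # S) ℤ.* + (m T))

  μ* : Subset n → ℤ
  μ* S = intervalSum S ⊤ (λ T → sgn (# T ∸ # S) ℤ.* + (m (∁ T)))

  bases : List (Subset n)
  bases = filter isBasis? (allSubsets n)

  𝓑 : List (Subset n × Subset n)
  𝓑 = concatMap (λ B → concatMap (λ T → replicate ∣ μ T ∣ (B , T))
                                  (filter (B ⊆?_) (allSubsets n)))
                 bases

  𝓑* : List (Subset n × Subset n)
  𝓑* = concatMap (λ B → concatMap (λ T̃ → replicate ∣ μ* T̃ ∣ (∁ B , T̃))
                                   (filter (∁ B ⊆?_) (allSubsets n)))
                  bases

  _≟ₚ_ : DecidableEquality (Subset n × Subset n)
  _≟ₚ_ = ProdP.≡-dec (VecP.≡-dec Bool._≟_) (VecP.≡-dec Bool._≟_)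

  record EquiBij : Set where
    field
      ψ     : Fin (length 𝓑) ↔ Fin (length 𝓑*)
      equid : ∀ B T T̃ → IsBasis B → B ⊆ T → ∁ B ⊆ T̃ →
              count (λ i → (lookup 𝓑 i ≟ₚ (B , T)) ×-dec
                           (lookup 𝓑* (Inverse.to ψ i) ≟ₚ (∁ B , T̃)))
                    (allFin (length 𝓑))
                ℕ.* m B
              ≡ ∣ μ T ∣ ℕ.* ∣ μ* T̃ ∣

  -- e(B , T) = |T \ B| and e*(B^c , T̃) = |T̃ \ B^c|
  -- (with no proper vectors every such element is externally active)
  e : Subset n × Subset n → ℕ
  e (B , T) = # (T ─ B)

  Mbar : EquiBij → ℤ → ℤ → ℤ
  Mbar Ψ x y =
    sumℤ (map (λ j → (x ℤ.^ e (lookup 𝓑* j)) ℤ.*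
                     (y ℤ.^ e (lookup 𝓑 (Inverse.from (EquiBij.ψ Ψ) j))))
              (allFin (length 𝓑*)))

-- Without proper vectors every vector is a loop or a coloop, so rk A = |A ∩ N| where N, the set
-- of free vectors, is the unique basis. All entries of 𝓑 are then (N , T) and all entries of 𝓑*
-- are (X ∖ N , T̃), and equidistribution turns M̄ into a product:
--   m(N) M̄_X(x , y) = (Σ_{T ⊇ N} μ(T) y^|T ∖ N|) (Σ_{T̃ ⊇ X ∖ N} μ*(T̃) x^|T̃ ∖ (X ∖ N)|).
-- For free v the deletion and the contraction are of the same kind, with N ∖ {v} as basis.
-- The y-factor of X equals that of X₂ (every T ⊇ N contains v), and axiom (3) shows that it is
-- m(N) / m(N ∖ {v}) times that of X₁. In the x-factor, the T̃ containing v contribute x times the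
-- x-factor of X₁, while μ*_X₂(T̃) = μ*_X(T̃) + μ*_X(T̃ ∪ {v}); since μ* ≥ 0 here by axiom (5), the
-- x-factor of X is that of X₂ plus (x - 1) times that of X₁. Clearing m(N) and m(N ∖ {v}) gives
-- the recursion.

module Submission where

open import Defs
open import Data.Nat as ℕ using (ℕ; zero; suc; _≤_; _<_; _∸_; s≤s; _≡ᵇ_)
import Data.Nat.Properties as ℕ
open import Data.Integer as ℤ using (ℤ; _+_; _*_; _-_; -_; +_; ∣_∣; _^_)
import Data.Integer.Properties as ℤ
open import Data.Integer.Tactic.RingSolver using (solve-∀)
open import Algebra.Properties.CommutativeSemigroup ℕ.+-commutativeSemigroup using (x∙yz≈y∙xz)
open import Algebra.Properties.CommutativeSemigroup ℤ.+-commutativeSemigroup using (interchange)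
import Algebra.Properties.CommutativeMonoid.Sum ℤ.+-0-commutativeMonoid as ℤSum
open import Data.Bool using (Bool; true; false; if_then_else_; not; _∧_; _∨_)
open import Data.Bool.Properties using (∧-identityʳ)
open import Data.Fin using (Fin; zero; suc)
open import Data.Vec as Vec using (Vec; []; _∷_; here; insertAt; removeAt; lookup; zipWith; replicate)
open import Data.Vec.Properties
  using (∷-injectiveʳ; map-insertAt; map-replicate; insertAt-removeAt; lookup∘tabulate)
open import Data.List as List using ([]; _∷_; _++_; map; filter; length; allFin)
open import Data.List.Properties using (map-++; map-∘; map-tabulate; filter-none)
import Data.List.Relation.Unary.All as All
open import Data.List.Relation.Unary.All.Properties using (concat⁺; map⁺; replicate⁺; all-filter)
open import Data.List.Membership.Propositional.Properties using (∈-lookup)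
open import Data.Fin.Subset using (Subset; _⊆_; _∪_; _∩_; _─_; ⁅_⁆; ∁; ⊤; ⊥) renaming (∣_∣ to #_)
open import Data.Fin.Subset.Properties
  using (_⊆?_; ⊆⊤; ⊆-trans; ⊆-antisym; drop-∷-⊆; p⊆p∪q; p∩q⊆q; x∈p∩q⁺; x∈∁p⇒x∉p; x∉∁p⇒x∈p;
         p⊆q⇒∣p∣≤∣q∣; ∣p∩q∣≤∣p∣; ∣p∩q∣≤∣q∣; ∣⊥∣≡0; ∣⊤∣≡n; ∣⁅x⁆∣≡1; ∣p∣≤n; ∣∁p∣≡n∸∣p∣;
         ∩-comm; ∩-idem; ∩-identityˡ; ∩-identityʳ; ∩-zeroˡ; ∩-zeroʳ; ∪-identityʳ; ∪-zeroʳ)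
open import Data.Product using (Σ; ∃₂; _×_; _,_; proj₁; proj₂)
open import Data.Sum using (inj₁; inj₂)
open import Data.Empty using () renaming (⊥ to Empty; ⊥-elim to absurd)
open import Function.Bundles using (Inverse)
open import Relation.Binary.PropositionalEquality
open import Relation.Nullary using (Dec; does; yes; no; ¬_; _×-dec_)
open import Relation.Nullary.Decidable using (dec-true; dec-false)

-- Subsets with an inserted coordinate

boolToℕ : Bool → ℕ
boolToℕ false = 0
boolToℕ true  = 1

#-∷ : ∀ {n} b (A : Subset n) → # (b ∷ A) ≡ boolToℕ b ℕ.+ # A
#-∷ false A = refl
#-∷ true  A = refl

#-insertAt : ∀ {n} (A : Subset n) v b → # (insertAt A v b) ≡ boolToℕ b ℕ.+ # A
#-insertAt A       zero    b = #-∷ b A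
#-insertAt (a ∷ A) (suc v) b = begin
  # (a ∷ insertAt A v b)              ≡⟨ #-∷ a (insertAt A v b) ⟩
  boolToℕ a ℕ.+ # (insertAt A v b)   ≡⟨ cong (boolToℕ a ℕ.+_) (#-insertAt A v b) ⟩
  boolToℕ a ℕ.+ (boolToℕ b ℕ.+ # A) ≡⟨ x∙yz≈y∙xz (boolToℕ a) (boolToℕ b) (# A) ⟩
  boolToℕ b ℕ.+ (boolToℕ a ℕ.+ # A) ≡⟨ cong (boolToℕ b ℕ.+_) (#-∷ a A) ⟨
  boolToℕ b ℕ.+ # (a ∷ A)            ∎
  where open ≡-Reasoning

insertAt-zipWith : ∀ {A B C : Set} {n} (f : A → B → C) (xs : Vec A n) (ys : Vec B n) v x y →
  zipWith f (insertAt xs v x) (insertAt ys v y) ≡ insertAt (zipWith f xs ys) v (f x y)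
insertAt-zipWith f xs       ys       zero    x y = refl
insertAt-zipWith f (a ∷ xs) (b ∷ ys) (suc v) x y = cong (f a b ∷_) (insertAt-zipWith f xs ys v x y)

replicate-insertAt : ∀ {A : Set} {n} (x : A) (v : Fin (suc n)) →
  replicate (suc n) x ≡ insertAt (replicate n x) v x
replicate-insertAt x zero = refl
replicate-insertAt {n = suc n} x (suc v) = cong (x ∷_) (replicate-insertAt x v)

⁅⁆-insertAt : ∀ {n} (v : Fin (suc n)) → ⁅ v ⁆ ≡ insertAt ⊥ v true
⁅⁆-insertAt zero = refl
⁅⁆-insertAt {suc n} (suc v) = cong (false ∷_) (⁅⁆-insertAt v)

does-insertAt-⊆? : ∀ {n} (A C : Subset n) v b c →
  does (insertAt A v b ⊆? insertAt C v c) ≡ (if b then c ∧ does (A ⊆? C) else does (A ⊆? C))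
does-insertAt-⊆? A C zero false c = refl
does-insertAt-⊆? A C zero true false = refl
does-insertAt-⊆? A C zero true true = refl
does-insertAt-⊆? (false ∷ A) (_ ∷ C) (suc v) b c = does-insertAt-⊆? A C v b c
does-insertAt-⊆? (true ∷ A) (true ∷ C) (suc v) b c = does-insertAt-⊆? A C v b c
does-insertAt-⊆? (true ∷ A) (false ∷ C) (suc v) false c = refl
does-insertAt-⊆? (true ∷ A) (false ∷ C) (suc v) true false = refl
does-insertAt-⊆? (true ∷ A) (false ∷ C) (suc v) true true = refl

∁⁅⁆-insertAt : ∀ {n} (v : Fin (suc n)) → ∁ ⁅ v ⁆ ≡ insertAt ⊤ v false
∁⁅⁆-insertAt {n} zero = cong (false ∷_) (map-replicate not false n)
∁⁅⁆-insertAt {suc n} (suc v) = cong (true ∷_) (∁⁅⁆-insertAt v)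

∣p∩q∣≡∣p∣≡∣q∣⇒p≡q : ∀ {n} (p q : Subset n) → # (p ∩ q) ≡ # p → # (p ∩ q) ≡ # q → p ≡ q
∣p∩q∣≡∣p∣≡∣q∣⇒p≡q []          []          _  _  = refl
∣p∩q∣≡∣p∣≡∣q∣⇒p≡q (true ∷ p)  (true ∷ q)  e₁ e₂ =
  cong (true ∷_) (∣p∩q∣≡∣p∣≡∣q∣⇒p≡q p q (ℕ.suc-injective e₁) (ℕ.suc-injective e₂))
∣p∩q∣≡∣p∣≡∣q∣⇒p≡q (false ∷ p) (false ∷ q) e₁ e₂ = cong (false ∷_) (∣p∩q∣≡∣p∣≡∣q∣⇒p≡q p q e₁ e₂)
∣p∩q∣≡∣p∣≡∣q∣⇒p≡q (true ∷ p)  (false ∷ q) e₁ _  = absurd (ℕ.<⇒≢ (s≤s (∣p∩q∣≤∣p∣ p q)) e₁)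
∣p∩q∣≡∣p∣≡∣q∣⇒p≡q (false ∷ p) (true ∷ q)  _  e₂ = absurd (ℕ.<⇒≢ (s≤s (∣p∩q∣≤∣q∣ p q)) e₂)

p⊆q⇒q∩p≡p : ∀ {n} {p q : Subset n} → p ⊆ q → q ∩ p ≡ p
p⊆q⇒q∩p≡p {p = p} {q} p⊆q = ⊆-antisym (p∩q⊆q q p) (λ x∈p → x∈p∩q⁺ (p⊆q x∈p , x∈p))

#-insertAt-∩ : ∀ {n} (A C : Subset n) v b c →
  # (insertAt A v b ∩ insertAt C v c) ≡ boolToℕ (b ∧ c) ℕ.+ # (A ∩ C)
#-insertAt-∩ A C v b c = trans (cong #_ (insertAt-zipWith _∧_ A C v b c)) (#-insertAt (A ∩ C) v (b ∧ c))

#≡0⇒≡⊥ : ∀ {n} (A : Subset n) → # A ≡ 0 → A ≡ ⊥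
#≡0⇒≡⊥ []          _     = refl
#≡0⇒≡⊥ (false ∷ A) #A≡0 = cong (false ∷_) (#≡0⇒≡⊥ A #A≡0)

#≡suc⇒insertAt : ∀ {n k} (A : Subset (suc n)) → # A ≡ suc k →
                 ∃₂ λ w (A′ : Subset n) → A ≡ insertAt A′ w true
#≡suc⇒insertAt         (true ∷ A)   _     = zero , A , refl
#≡suc⇒insertAt {zero}  (false ∷ []) ()
#≡suc⇒insertAt {suc n} (false ∷ A)  #A≡1+k with #≡suc⇒insertAt A #A≡1+k
... | w , A′ , refl = suc w , false ∷ A′ , refl

#-insertAt-inside-∩ : ∀ {n} (A : Subset n) v (N : Subset (suc n)) →
  # (insertAt A v true ∩ N) ≡ boolToℕ (lookup N v) ℕ.+ # (insertAt A v false ∩ N)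
#-insertAt-inside-∩ A v N = begin
  # (insertAt A v true ∩ N)                            ≡⟨ cong (λ N → # (insertAt A v true ∩ N)) N≡ ⟩
  # (insertAt A v true ∩ insertAt N′ v c)              ≡⟨ #-insertAt-∩ A N′ v true c ⟩
  boolToℕ c ℕ.+ # (A ∩ N′)                             ≡⟨ cong (boolToℕ c ℕ.+_) (#-insertAt-∩ A N′ v false c) ⟨
  boolToℕ c ℕ.+ # (insertAt A v false ∩ insertAt N′ v c) ≡⟨ cong (λ N → boolToℕ c ℕ.+ # (insertAt A v false ∩ N)) N≡ ⟨
  boolToℕ c ℕ.+ # (insertAt A v false ∩ N)             ∎
  where
  open ≡-Reasoning
  N′ = removeAt N v
  c  = lookup N v
  N≡ : N ≡ insertAt N′ v c
  N≡ = sym (insertAt-removeAt N v)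

insertAt-inside-∪-∁⁅⁆ : ∀ {n} (A : Subset n) w → insertAt A w true ∪ ∁ ⁅ w ⁆ ≡ ⊤
insertAt-inside-∪-∁⁅⁆ A w = begin
  insertAt A w true ∪ ∁ ⁅ w ⁆            ≡⟨ cong (insertAt A w true ∪_) (∁⁅⁆-insertAt w) ⟩
  insertAt A w true ∪ insertAt ⊤ w false ≡⟨ insertAt-zipWith _∨_ A ⊤ w true false ⟩
  insertAt (A ∪ ⊤) w true                ≡⟨ cong (λ B → insertAt B w true) (∪-zeroʳ A) ⟩
  insertAt ⊤ w true                      ≡⟨ replicate-insertAt true w ⟨
  ⊤                                      ∎
  where open ≡-Reasoning

insertAt-inside-∩-∁⁅⁆ : ∀ {n} (A : Subset n) w → insertAt A w true ∩ ∁ ⁅ w ⁆ ≡ insertAt A w false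
insertAt-inside-∩-∁⁅⁆ A w = begin
  insertAt A w true ∩ ∁ ⁅ w ⁆            ≡⟨ cong (insertAt A w true ∩_) (∁⁅⁆-insertAt w) ⟩
  insertAt A w true ∩ insertAt ⊤ w false ≡⟨ insertAt-zipWith _∧_ A ⊤ w true false ⟩
  insertAt (A ∩ ⊤) w false               ≡⟨ cong (λ B → insertAt B w false) (∩-identityʳ A) ⟩
  insertAt A w false                     ∎
  where open ≡-Reasoning

⊆-transport : ∀ {m n} {A C : Subset m} {B D : Subset n} → does (A ⊆? C) ≡ does (B ⊆? D) → A ⊆ C → B ⊆ D
⊆-transport {A = A} {C} {B} {D} eq A⊆C = from-does (B ⊆? D) (trans (sym eq) (dec-true (A ⊆? C) A⊆C))
  where
  from-does : ∀ {P : Set} (P? : Dec P) → does P? ≡ true → P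
  from-does (yes p) _ = p

insertAt-⊆⁺ : ∀ {n} {A C : Subset n} v c → A ⊆ C → insertAt A v false ⊆ insertAt C v c
insertAt-⊆⁺ {A = A} {C} v c = ⊆-transport (sym (does-insertAt-⊆? A C v false c))

insertAt-⊆⁻ : ∀ {n} {A C : Subset n} v c → insertAt A v false ⊆ insertAt C v c → A ⊆ C
insertAt-⊆⁻ {A = A} {C} v c = ⊆-transport (does-insertAt-⊆? A C v false c)

p⊆q⇒p∪[q─p]≡q : ∀ {n} {p q : Subset n} → p ⊆ q → p ∪ (q ─ p) ≡ q
p⊆q⇒p∪[q─p]≡q {p = []}        {[]}        _   = refl
p⊆q⇒p∪[q─p]≡q {p = true ∷ p}  {true ∷ q}  p⊆q = cong (true ∷_) (p⊆q⇒p∪[q─p]≡q (drop-∷-⊆ p⊆q))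
p⊆q⇒p∪[q─p]≡q {p = false ∷ p} {x ∷ q}     p⊆q = cong (x ∷_) (p⊆q⇒p∪[q─p]≡q (drop-∷-⊆ p⊆q))
p⊆q⇒p∪[q─p]≡q {p = true ∷ p}  {false ∷ q} p⊆q with p⊆q here
... | ()

p∩[q─p]≡⊥ : ∀ {n} (p q : Subset n) → p ∩ (q ─ p) ≡ ⊥
p∩[q─p]≡⊥ []          []      = refl
p∩[q─p]≡⊥ (true ∷ p)  (_ ∷ q) = cong (false ∷_) (p∩[q─p]≡⊥ p q)
p∩[q─p]≡⊥ (false ∷ p) (_ ∷ q) = cong (false ∷_) (p∩[q─p]≡⊥ p q)

#-insertAt-─-inside : ∀ {n} (A C : Subset n) v b → # (insertAt A v b ─ insertAt C v true) ≡ # (A ─ C)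
#-insertAt-─-inside A C v b = trans (cong #_ (insertAt-zipWith _ A C v b true)) (#-insertAt (A ─ C) v false)

#-insertAt-─-outside : ∀ {n} (A C : Subset n) v b → # (insertAt A v b ─ insertAt C v false) ≡ boolToℕ b ℕ.+ # (A ─ C)
#-insertAt-─-outside A C v b = trans (cong #_ (insertAt-zipWith _ A C v b false)) (#-insertAt (A ─ C) v b)

-- Sums over subsets

∑ : ∀ n → (Subset n → ℤ) → ℤ
∑ zero    f = f []
∑ (suc n) f = ∑ n (λ A → f (false ∷ A)) + ∑ n (λ A → f (true ∷ A))

∑-cong : ∀ n {f g : Subset n → ℤ} → (∀ A → f A ≡ g A) → ∑ n f ≡ ∑ n g
∑-cong zero    f≗g = f≗g []
∑-cong (suc n) f≗g = cong₂ _+_ (∑-cong n (λ A → f≗g _)) (∑-cong n (λ A → f≗g _))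

∑-zero : ∀ n {f : Subset n → ℤ} → (∀ A → f A ≡ + 0) → ∑ n f ≡ + 0
∑-zero zero    f≗0 = f≗0 []
∑-zero (suc n) f≗0 = cong₂ _+_ (∑-zero n (λ A → f≗0 _)) (∑-zero n (λ A → f≗0 _))

∑-+ : ∀ n (f g : Subset n → ℤ) → ∑ n (λ A → f A + g A) ≡ ∑ n f + ∑ n g
∑-+ zero    f g = refl
∑-+ (suc n) f g = begin
  ∑ n (λ A → f (false ∷ A) + g (false ∷ A)) + ∑ n (λ A → f (true ∷ A) + g (true ∷ A))
    ≡⟨ cong₂ _+_ (∑-+ n _ _) (∑-+ n _ _) ⟩
  (∑ n (λ A → f (false ∷ A)) + ∑ n (λ A → g (false ∷ A)))
    + (∑ n (λ A → f (true ∷ A)) + ∑ n (λ A → g (true ∷ A)))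
    ≡⟨ interchange (∑ n (λ A → f (false ∷ A))) _ _ _ ⟩
  ∑ (suc n) f + ∑ (suc n) g ∎
  where open ≡-Reasoning

*-distribˡ-∑ : ∀ n (c : ℤ) (f : Subset n → ℤ) → ∑ n (λ A → c * f A) ≡ c * ∑ n f
*-distribˡ-∑ zero    c f = refl
*-distribˡ-∑ (suc n) c f =
  trans (cong₂ _+_ (*-distribˡ-∑ n c _) (*-distribˡ-∑ n c _)) (sym (ℤ.*-distribˡ-+ c _ _))

∑-*-∑ : ∀ m n (f : Subset m → ℤ) (g : Subset n → ℤ) →
        ∑ m (λ A → ∑ n (λ B → f A * g B)) ≡ ∑ m f * ∑ n g
∑-*-∑ m n f g = begin
  ∑ m (λ A → ∑ n (λ B → f A * g B)) ≡⟨ ∑-cong m (λ A → *-distribˡ-∑ n (f A) g) ⟩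
  ∑ m (λ A → f A * ∑ n g)           ≡⟨ ∑-cong m (λ A → ℤ.*-comm (f A) (∑ n g)) ⟩
  ∑ m (λ A → ∑ n g * f A)           ≡⟨ *-distribˡ-∑ m (∑ n g) f ⟩
  ∑ n g * ∑ m f                     ≡⟨ ℤ.*-comm (∑ n g) (∑ m f) ⟩
  ∑ m f * ∑ n g                     ∎
  where open ≡-Reasoning

∑-pointed : ∀ n (f : Subset n → ℤ) B → (∀ A → ¬ A ≡ B → f A ≡ + 0) → ∑ n f ≡ f B
∑-pointed zero    f [] _ = refl
∑-pointed (suc n) f (false ∷ B) f≗0 =
  trans (cong₂ _+_ (∑-pointed n _ B (λ A A≢B → f≗0 _ (λ eq → A≢B (∷-injectiveʳ eq)))) (∑-zero n (λ A → f≗0 _ (λ ()))))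
        (ℤ.+-identityʳ _)
∑-pointed (suc n) f (true ∷ B) f≗0 =
  trans (cong₂ _+_ (∑-zero n (λ A → f≗0 _ (λ ()))) (∑-pointed n _ B (λ A A≢B → f≗0 _ (λ eq → A≢B (∷-injectiveʳ eq)))))
        (ℤ.+-identityˡ _)

∑-insertAt : ∀ n (v : Fin (suc n)) (f : Subset (suc n) → ℤ) →
  ∑ (suc n) f ≡ ∑ n (λ A → f (insertAt A v false)) + ∑ n (λ A → f (insertAt A v true))
∑-insertAt n       zero    f = refl
∑-insertAt (suc n) (suc v) f =
  trans (cong₂ _+_ (∑-insertAt n v (λ A → f (false ∷ A))) (∑-insertAt n v (λ A → f (true ∷ A))))
        (interchange (∑ n (λ A → f (false ∷ insertAt A v false))) _ _ _)

sumℤ-++ : ∀ xs ys → sumℤ (xs ++ ys) ≡ sumℤ xs + sumℤ ys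
sumℤ-++ []       ys = sym (ℤ.+-identityˡ _)
sumℤ-++ (x ∷ xs) ys = trans (cong (λ s → x + s) (sumℤ-++ xs ys)) (sym (ℤ.+-assoc x _ _))

sumℤ-allSubsets : ∀ n (f : Subset n → ℤ) → sumℤ (map f (allSubsets n)) ≡ ∑ n f
sumℤ-allSubsets zero    f = ℤ.+-identityʳ _
sumℤ-allSubsets (suc n) f = begin
  sumℤ (map f (map (false ∷_) S ++ map (true ∷_) S))
    ≡⟨ cong sumℤ (map-++ f (map (false ∷_) S) _) ⟩
  sumℤ (map f (map (false ∷_) S) ++ map f (map (true ∷_) S))
    ≡⟨ sumℤ-++ (map f (map (false ∷_) S)) _ ⟩
  sumℤ (map f (map (false ∷_) S)) + sumℤ (map f (map (true ∷_) S))
    ≡⟨ cong₂ _+_ (cong sumℤ (sym (map-∘ S))) (cong sumℤ (sym (map-∘ S))) ⟩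
  sumℤ (map (λ A → f (false ∷ A)) S) + sumℤ (map (λ A → f (true ∷ A)) S)
    ≡⟨ cong₂ _+_ (sumℤ-allSubsets n _) (sumℤ-allSubsets n _) ⟩
  ∑ (suc n) f ∎
  where
  open ≡-Reasoning
  S = allSubsets n

sumℤ-filter : ∀ {A : Set} {P : A → Set} (P? : ∀ a → Dec (P a)) (f : A → ℤ) xs →
  sumℤ (map f (filter P? xs)) ≡ sumℤ (map (λ a → if does (P? a) then f a else + 0) xs)
sumℤ-filter P? f []       = refl
sumℤ-filter P? f (x ∷ xs) with does (P? x)
... | true  = cong (λ s → f x + s) (sumℤ-filter P? f xs)
... | false = trans (sumℤ-filter P? f xs) (sym (ℤ.+-identityˡ _))

∑⊇ : ∀ {n} → Subset n → (Subset n → ℤ) → ℤ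
∑⊇ {n} A f = ∑ n (λ T → if does (A ⊆? T) then f T else + 0)

intervalSum-⊤ : ∀ {n} (A : Subset n) f → intervalSum A ⊤ f ≡ ∑⊇ A f
intervalSum-⊤ {n} A f = begin
  intervalSum A ⊤ f
    ≡⟨ sumℤ-filter (λ T → (A ⊆? T) ×-dec (T ⊆? ⊤)) f (allSubsets n) ⟩
  sumℤ (map (λ T → if does (A ⊆? T) ∧ does (T ⊆? ⊤) then f T else + 0) (allSubsets n))
    ≡⟨ sumℤ-allSubsets n _ ⟩
  ∑ n (λ T → if does (A ⊆? T) ∧ does (T ⊆? ⊤) then f T else + 0)
    ≡⟨ ∑-cong n (λ T → cong (λ b → if does (A ⊆? T) ∧ b then f T else + 0) (dec-true (T ⊆? ⊤) ⊆⊤)) ⟩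
  ∑ n (λ T → if does (A ⊆? T) ∧ true then f T else + 0)
    ≡⟨ ∑-cong n (λ T → cong (λ b → if b then f T else + 0) (∧-identityʳ (does (A ⊆? T)))) ⟩
  ∑⊇ A f ∎
  where open ≡-Reasoning

∑⊇-cong : ∀ {n} (A : Subset n) {f g : Subset n → ℤ} → (∀ T → A ⊆ T → f T ≡ g T) → ∑⊇ A f ≡ ∑⊇ A g
∑⊇-cong {n} A f≗g = ∑-cong n restrict
  where
  restrict : ∀ T → (if does (A ⊆? T) then _ else + 0) ≡ (if does (A ⊆? T) then _ else + 0)
  restrict T with A ⊆? T
  ... | yes A⊆T = f≗g T A⊆T
  ... | no  _   = refl

*-distribˡ-∑⊇ : ∀ {n} (A : Subset n) c f → ∑⊇ A (λ T → c * f T) ≡ c * ∑⊇ A f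
*-distribˡ-∑⊇ {n} A c f = trans (∑-cong n pull) (*-distribˡ-∑ n c _)
  where
  pull : ∀ T → (if does (A ⊆? T) then c * f T else + 0) ≡ c * (if does (A ⊆? T) then f T else + 0)
  pull T with does (A ⊆? T)
  ... | true  = refl
  ... | false = sym (ℤ.*-zeroʳ c)

∑⊇-insertAt-inside : ∀ {n} (A : Subset n) v f →
  ∑⊇ (insertAt A v true) f ≡ ∑⊇ A (λ T → f (insertAt T v true))
∑⊇-insertAt-inside {n} A v f = begin
  ∑⊇ (insertAt A v true) f
    ≡⟨ ∑-insertAt n v (λ T → if does (insertAt A v true ⊆? T) then f T else + 0) ⟩
  ∑ n (λ T → if does (insertAt A v true ⊆? insertAt T v false) then f (insertAt T v false) else + 0)
    + ∑ n (λ T → if does (insertAt A v true ⊆? insertAt T v true) then f (insertAt T v true) else + 0)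
    ≡⟨ cong₂ _+_ (∑-zero n (λ T → cong (λ b → if b then _ else + 0) (does-insertAt-⊆? A T v true false)))
                 (∑-cong n (λ T → cong (λ b → if b then _ else + 0) (does-insertAt-⊆? A T v true true))) ⟩
  + 0 + ∑⊇ A (λ T → f (insertAt T v true))
    ≡⟨ ℤ.+-identityˡ _ ⟩
  ∑⊇ A (λ T → f (insertAt T v true)) ∎
  where open ≡-Reasoning

∑⊇-insertAt-outside : ∀ {n} (A : Subset n) v f →
  ∑⊇ (insertAt A v false) f ≡ ∑⊇ A (λ T → f (insertAt T v false)) + ∑⊇ A (λ T → f (insertAt T v true))
∑⊇-insertAt-outside {n} A v f =
  trans (∑-insertAt n v (λ T → if does (insertAt A v false ⊆? T) then f T else + 0))
        (cong₂ _+_ (∑-cong n (λ T → cong (λ b → if b then _ else + 0) (does-insertAt-⊆? A T v false false)))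
                   (∑-cong n (λ T → cong (λ b → if b then _ else + 0) (does-insertAt-⊆? A T v false true))))

∑⊇-+ : ∀ {n} (A : Subset n) f g → ∑⊇ A (λ T → f T + g T) ≡ ∑⊇ A f + ∑⊇ A g
∑⊇-+ {n} A f g = trans (∑-cong n split) (∑-+ n _ _)
  where
  split : ∀ T → (if does (A ⊆? T) then f T + g T else + 0)
              ≡ (if does (A ⊆? T) then f T else + 0) + (if does (A ⊆? T) then g T else + 0)
  split T with does (A ⊆? T)
  ... | true  = refl
  ... | false = refl

count-∷ : ∀ {A : Set} {P : A → Set} (P? : ∀ a → Dec (P a)) x xs →
          count P? (x ∷ xs) ≡ boolToℕ (does (P? x)) ℕ.+ count P? xs
count-∷ P? x xs with does (P? x)
... | true  = refl
... | false = refl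

count-none : ∀ {A : Set} {P : A → Set} (P? : ∀ a → Dec (P a)) xs → (∀ a → ¬ P a) → count P? xs ≡ 0
count-none P? xs ¬P = cong length (filter-none P? {xs} (All.tabulate (λ _ → ¬P _)))

sumℤ-allFin : ∀ n (f : Fin n → ℤ) → sumℤ (map f (allFin n)) ≡ ℤSum.sum f
sumℤ-allFin n f = trans (cong sumℤ (map-tabulate (λ i → i) f)) (sumℤ-tabulate n f)
  where
  sumℤ-tabulate : ∀ n (f : Fin n → ℤ) → sumℤ (List.tabulate f) ≡ ℤSum.sum f
  sumℤ-tabulate zero    f = refl
  sumℤ-tabulate (suc n) f = cong (λ s → f zero + s) (sumℤ-tabulate n (λ i → f (suc i)))

module _ {I : Set} {k} (f g : I → Subset k) {P : Subset k → Subset k → I → Set}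
         (P? : ∀ T T̃ i → Dec (P T T̃ i))
         (P⇒≡ : ∀ {T T̃ i} → P T T̃ i → T ≡ f i × T̃ ≡ g i)
         (P-refl : ∀ i → P (f i) (g i) i)
         (H : Subset k → Subset k → ℤ) where

  private
    fibre-indicator : ∀ i → ∑ k (λ T → ∑ k (λ T̃ → + boolToℕ (does (P? T T̃ i)) * H T T̃)) ≡ H (f i) (g i)
    fibre-indicator i = begin
      ∑ k (λ T → ∑ k (λ T̃ → + boolToℕ (does (P? T T̃ i)) * H T T̃))
        ≡⟨ ∑-pointed k _ (f i) (λ T T≢fi → ∑-zero k (λ T̃ → outside T≢fi (λ p → proj₁ (P⇒≡ p)))) ⟩
      ∑ k (λ T̃ → + boolToℕ (does (P? (f i) T̃ i)) * H (f i) T̃)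
        ≡⟨ ∑-pointed k _ (g i) (λ T̃ T̃≢gi → outside T̃≢gi (λ p → proj₂ (P⇒≡ p))) ⟩
      + boolToℕ (does (P? (f i) (g i) i)) * H (f i) (g i)
        ≡⟨ cong (λ b → + boolToℕ b * H (f i) (g i)) (dec-true (P? (f i) (g i) i) (P-refl i)) ⟩
      + 1 * H (f i) (g i)
        ≡⟨ ℤ.*-identityˡ _ ⟩
      H (f i) (g i) ∎
      where
      open ≡-Reasoning
      outside : ∀ {T T̃ : Subset k} {S S′ : Subset k} → ¬ S ≡ S′ → (P T T̃ i → S ≡ S′) →
                + boolToℕ (does (P? T T̃ i)) * H T T̃ ≡ + 0
      outside {T} {T̃} S≢S′ P⇒S≡S′ =
        trans (cong (λ b → + boolToℕ b * H T T̃) (dec-false (P? T T̃ i) (λ p → S≢S′ (P⇒S≡S′ p))))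
              (ℤ.*-zeroˡ (H T T̃))

  sumℤ-by-fibres : ∀ is → sumℤ (map (λ i → H (f i) (g i)) is)
                          ≡ ∑ k (λ T → ∑ k (λ T̃ → + count (P? T T̃) is * H T T̃))
  sumℤ-by-fibres []       = sym (∑-zero k (λ T → ∑-zero k (λ T̃ → ℤ.*-zeroˡ (H T T̃))))
  sumℤ-by-fibres (i ∷ is) = sym (begin
    ∑ k (λ T → ∑ k (λ T̃ → + count (P? T T̃) (i ∷ is) * H T T̃))
      ≡⟨ ∑-cong k (λ T → ∑-cong k (λ T̃ → split T T̃)) ⟩
    ∑ k (λ T → ∑ k (λ T̃ → + boolToℕ (does (P? T T̃ i)) * H T T̃ + + count (P? T T̃) is * H T T̃))
      ≡⟨ ∑-cong k (λ T → ∑-+ k _ _) ⟩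
    ∑ k (λ T → ∑ k (λ T̃ → + boolToℕ (does (P? T T̃ i)) * H T T̃) + ∑ k (λ T̃ → + count (P? T T̃) is * H T T̃))
      ≡⟨ ∑-+ k _ _ ⟩
    ∑ k (λ T → ∑ k (λ T̃ → + boolToℕ (does (P? T T̃ i)) * H T T̃))
      + ∑ k (λ T → ∑ k (λ T̃ → + count (P? T T̃) is * H T T̃))
      ≡⟨ cong₂ _+_ (fibre-indicator i) (sym (sumℤ-by-fibres is)) ⟩
    H (f i) (g i) + sumℤ (map (λ i → H (f i) (g i)) is) ∎)
    where
    open ≡-Reasoning
    split : ∀ T T̃ → + count (P? T T̃) (i ∷ is) * H T T̃
                  ≡ + boolToℕ (does (P? T T̃ i)) * H T T̃ + + count (P? T T̃) is * H T T̃
    split T T̃ = trans (cong (λ c → + c * H T T̃) (count-∷ (P? T T̃) i is))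
                      (trans (cong (_* H T T̃) (ℤ.pos-+ (boolToℕ (does (P? T T̃ i))) _))
                             (ℤ.*-distribʳ-+ (H T T̃) (+ boolToℕ (does (P? T T̃ i))) (+ count (P? T T̃) is)))

-- Matroids all of whose vectors are loops or coloops

-- rk is the rank function of the matroid with coloops N and loops ∁ N.
ColoopRank : ∀ {n} → (Subset n → ℕ) → Subset n → Set
ColoopRank rk N = ∀ A → rk A ≡ # (A ∩ N)

module _ {n} {rk : Subset n → ℕ} {N : Subset n} (rk≗ : ColoopRank rk N) where

  ColoopRank-rk⊤ : rk ⊤ ≡ # N
  ColoopRank-rk⊤ = trans (rk≗ ⊤) (cong #_ (∩-identityˡ N))

  ColoopRank-IsBasis : ∀ m → IsBasis rk m N
  ColoopRank-IsBasis m = sym rkN , trans rkN (sym ColoopRank-rk⊤)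
    where rkN = trans (rk≗ N) (cong #_ (∩-idem N))

  ColoopRank-basis-unique : ∀ m {B} → IsBasis rk m B → B ≡ N
  ColoopRank-basis-unique m {B} (#B≡rkB , rkB≡rk⊤) =
    ∣p∩q∣≡∣p∣≡∣q∣⇒p≡q B N (trans (sym (rk≗ B)) (sym #B≡rkB))
                          (trans (sym (rk≗ B)) (trans rkB≡rk⊤ ColoopRank-rk⊤))

module _ {n} {rk : Subset (suc n) → ℕ} (N₁ : Subset n) (v : Fin (suc n)) (c : Bool)
         (rk≗ : ColoopRank rk (insertAt N₁ v c)) where

  ColoopRank-rk⁅⁆ : rk ⁅ v ⁆ ≡ boolToℕ c
  ColoopRank-rk⁅⁆ = begin
    rk ⁅ v ⁆                                         ≡⟨ rk≗ ⁅ v ⁆ ⟩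
    # (⁅ v ⁆ ∩ insertAt N₁ v c)                      ≡⟨ cong (λ A → # (A ∩ insertAt N₁ v c)) (⁅⁆-insertAt v) ⟩
    # (insertAt ⊥ v true ∩ insertAt N₁ v c)          ≡⟨ #-insertAt-∩ ⊥ N₁ v true c ⟩
    boolToℕ c ℕ.+ # (⊥ ∩ N₁)                         ≡⟨ cong (λ A → boolToℕ c ℕ.+ # A) (∩-zeroˡ N₁) ⟩
    boolToℕ c ℕ.+ # (⊥ {n})                          ≡⟨ cong (boolToℕ c ℕ.+_) (∣⊥∣≡0 n) ⟩
    boolToℕ c ℕ.+ 0                                  ≡⟨ ℕ.+-identityʳ _ ⟩
    boolToℕ c                                        ∎
    where open ≡-Reasoning

  ColoopRank-rk∁⁅⁆ : rk (∁ ⁅ v ⁆) ≡ # N₁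
  ColoopRank-rk∁⁅⁆ = begin
    rk (∁ ⁅ v ⁆)                                ≡⟨ rk≗ (∁ ⁅ v ⁆) ⟩
    # (∁ ⁅ v ⁆ ∩ insertAt N₁ v c)                ≡⟨ cong (λ A → # (A ∩ insertAt N₁ v c)) (∁⁅⁆-insertAt v) ⟩
    # (insertAt ⊤ v false ∩ insertAt N₁ v c)    ≡⟨ #-insertAt-∩ ⊤ N₁ v false c ⟩
    # (⊤ ∩ N₁)                                  ≡⟨ cong #_ (∩-identityˡ N₁) ⟩
    # N₁                                        ∎
    where open ≡-Reasoning

  ColoopRank-rk⊤-insertAt : rk ⊤ ≡ boolToℕ c ℕ.+ # N₁
  ColoopRank-rk⊤-insertAt = trans (ColoopRank-rk⊤ rk≗) (#-insertAt N₁ v c)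

ColoopRank⇒NoProper : ∀ {n} {rk : Subset n → ℕ} {N} → ColoopRank rk N → NoProper rk
ColoopRank⇒NoProper {suc n} {rk} {N} rk≗ w (rk∁≡rk⊤ , suc[rk⊤∸rkw]≡rk⊤) =
  notProper (lookup N w) (subst (ColoopRank rk) (sym (insertAt-removeAt N w)) rk≗)
  where
  notProper : ∀ c → ColoopRank rk (insertAt (removeAt N w) w c) → Empty
  notProper true  rk≗′ = ℕ.<⇒≢ (ℕ.n<1+n _)
    (trans (sym (ColoopRank-rk∁⁅⁆ _ w true rk≗′)) (trans rk∁≡rk⊤ (ColoopRank-rk⊤-insertAt _ w true rk≗′)))
  notProper false rk≗′ = ℕ.<⇒≢ (ℕ.n<1+n (rk ⊤))
    (sym (trans (cong (λ r → suc (rk ⊤ ∸ r)) (sym (ColoopRank-rk⁅⁆ _ w false rk≗′))) suc[rk⊤∸rkw]≡rk⊤))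

module _ {n} {rk : Subset (suc n) → ℕ} {N₁ : Subset n} {v : Fin (suc n)}
         (rk≗ : ColoopRank rk (insertAt N₁ v true)) where

  ColoopRank-delRk : ColoopRank (delRk rk v) N₁
  ColoopRank-delRk A = trans (rk≗ _) (#-insertAt-∩ A N₁ v false true)

  ColoopRank-conRk : ColoopRank (conRk rk v) N₁
  ColoopRank-conRk A =
    cong₂ _∸_ (trans (rk≗ _) (#-insertAt-∩ A N₁ v true true)) (ColoopRank-rk⁅⁆ N₁ v true rk≗)

-- Without proper vectors, the vectors of rank one are exactly the coloops.
coloops : ∀ {n} → (Subset n → ℕ) → Subset n
coloops rk = Vec.tabulate (λ w → rk ⁅ w ⁆ ≡ᵇ 1)

module _ {n} (M : ArithMatroid (suc n)) where
  open ArithMatroid M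

  rk⁅⁆≤1 : ∀ w → rk ⁅ w ⁆ ≤ 1
  rk⁅⁆≤1 w = subst (rk ⁅ w ⁆ ≤_) (∣⁅x⁆∣≡1 w) (rk-bound ⁅ w ⁆)

  private
    insertAt-inside≡∪⁅⁆ : ∀ (A : Subset n) w → insertAt A w true ≡ insertAt A w false ∪ ⁅ w ⁆
    insertAt-inside≡∪⁅⁆ A w = sym (begin
      insertAt A w false ∪ ⁅ w ⁆            ≡⟨ cong (insertAt A w false ∪_) (⁅⁆-insertAt w) ⟩
      insertAt A w false ∪ insertAt ⊥ w true ≡⟨ insertAt-zipWith _∨_ A ⊥ w false true ⟩
      insertAt (A ∪ ⊥) w true               ≡⟨ cong (λ B → insertAt B w true) (∪-identityʳ A) ⟩
      insertAt A w true                     ∎)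
      where open ≡-Reasoning

  rk-insertAt-≤ : ∀ (A : Subset n) w → rk (insertAt A w true) ≤ rk (insertAt A w false) ℕ.+ rk ⁅ w ⁆
  rk-insertAt-≤ A w rewrite insertAt-inside≡∪⁅⁆ A w =
    ℕ.≤-trans (ℕ.m≤m+n _ _) (rk-submod (insertAt A w false) ⁅ w ⁆)

  rk-insertAt-mono : ∀ (A : Subset n) w → rk (insertAt A w false) ≤ rk (insertAt A w true)
  rk-insertAt-mono A w rewrite insertAt-inside≡∪⁅⁆ A w = rk-mono _ _ (p⊆p∪q ⁅ w ⁆)

  Free⇒∈coloops : ∀ v → Free rk v → lookup (coloops rk) v ≡ true
  Free⇒∈coloops v (_ , suc[rk⊤∸rkv]≡rk⊤) rewrite lookup∘tabulate (λ w → rk ⁅ w ⁆ ≡ᵇ 1) v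
    with rk ⁅ v ⁆ | rk⁅⁆≤1 v
  ... | zero     | _ = absurd (ℕ.<⇒≢ (ℕ.n<1+n (rk ⊤)) (sym suc[rk⊤∸rkv]≡rk⊤))
  ... | suc zero | _ = refl
  ... | suc (suc _) | s≤s ()

  module _ (noProper : NoProper rk) where

    rank-one⇒coloop : ∀ w → rk ⁅ w ⁆ ≡ 1 → rk (∁ ⁅ w ⁆) < rk ⊤
    rank-one⇒coloop w rkw≡1 with ℕ.m≤n⇒m<n∨m≡n (rk-mono (∁ ⁅ w ⁆) ⊤ ⊆⊤)
    ... | inj₁ rk∁<rk⊤ = rk∁<rk⊤
    ... | inj₂ rk∁≡rk⊤ = absurd (noProper w (rk∁≡rk⊤ , suc[rk⊤∸1]≡rk⊤))
      where
      suc[rk⊤∸1]≡rk⊤ : suc (rk ⊤ ∸ rk ⁅ w ⁆) ≡ rk ⊤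
      suc[rk⊤∸1]≡rk⊤ rewrite rkw≡1 =
        ℕ.suc-pred (rk ⊤) {{ℕ.>-nonZero (subst (_≤ rk ⊤) rkw≡1 (rk-mono _ _ ⊆⊤))}}

    -- Submodularity with X ∖ {w}, whose rank is below rk X since w is a coloop.
    rank-one⇒rk-insertAt : ∀ (A : Subset n) w → rk ⁅ w ⁆ ≡ 1 →
                           suc (rk (insertAt A w false)) ≤ rk (insertAt A w true)
    rank-one⇒rk-insertAt A w rkw≡1 = ℕ.+-cancelˡ-< (rk ⊤) _ _ (begin-strict
      rk ⊤ ℕ.+ rk (insertAt A w false)        ≡⟨ cong₂ (λ B C → rk B ℕ.+ rk C) (insertAt-inside-∪-∁⁅⁆ A w) (insertAt-inside-∩-∁⁅⁆ A w) ⟨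
      rk (A+w ∪ ∁ ⁅ w ⁆) ℕ.+ rk (A+w ∩ ∁ ⁅ w ⁆) ≤⟨ rk-submod A+w (∁ ⁅ w ⁆) ⟩
      rk A+w ℕ.+ rk (∁ ⁅ w ⁆)                  <⟨ ℕ.+-monoʳ-< (rk A+w) (rank-one⇒coloop w rkw≡1) ⟩
      rk A+w ℕ.+ rk ⊤                          ≡⟨ ℕ.+-comm (rk A+w) (rk ⊤) ⟩
      rk ⊤ ℕ.+ rk A+w                          ∎)
      where
      open ℕ.≤-Reasoning
      A+w = insertAt A w true

    rk-insertAt : ∀ (A : Subset n) w →
                  rk (insertAt A w true) ≡ boolToℕ (lookup (coloops rk) w) ℕ.+ rk (insertAt A w false)
    rk-insertAt A w rewrite lookup∘tabulate (λ w → rk ⁅ w ⁆ ≡ᵇ 1) w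
      with rk ⁅ w ⁆ in rkw≡ | rk⁅⁆≤1 w
    ... | zero | _ = ℕ.≤-antisym
      (subst (rk (insertAt A w true) ≤_) (trans (cong (rk (insertAt A w false) ℕ.+_) rkw≡) (ℕ.+-identityʳ _))
             (rk-insertAt-≤ A w))
      (rk-insertAt-mono A w)
    ... | suc zero | _ = ℕ.≤-antisym
      (subst (rk (insertAt A w true) ≤_) (trans (cong (rk (insertAt A w false) ℕ.+_) rkw≡) (ℕ.+-comm _ 1))
             (rk-insertAt-≤ A w))
      (rank-one⇒rk-insertAt A w rkw≡)
    ... | suc (suc _) | s≤s ()

    NoProper⇒ColoopRank : ColoopRank rk (coloops rk)
    NoProper⇒ColoopRank A = rank-by-size (# A) A refl
      where
      N = coloops rk
      rank-by-size : ∀ k A → # A ≡ k → rk A ≡ # (A ∩ N)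
      rank-by-size zero A #A≡0 rewrite #≡0⇒≡⊥ A #A≡0 =
        trans (ℕ.n≤0⇒n≡0 (subst (rk ⊥ ≤_) (∣⊥∣≡0 (suc n)) (rk-bound ⊥)))
              (sym (trans (cong #_ (∩-zeroˡ N)) (∣⊥∣≡0 (suc n))))
      rank-by-size (suc k) A #A≡1+k with #≡suc⇒insertAt A #A≡1+k
      ... | w , A′ , refl = begin
        rk (insertAt A′ w true)                       ≡⟨ rk-insertAt A′ w ⟩
        boolToℕ c ℕ.+ rk (insertAt A′ w false)        ≡⟨ cong (boolToℕ c ℕ.+_) (rank-by-size k _ #A′≡k) ⟩
        boolToℕ c ℕ.+ # (insertAt A′ w false ∩ N)     ≡⟨ #-insertAt-inside-∩ A′ w N ⟨
        # (insertAt A′ w true ∩ N)                    ∎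
        where
        open ≡-Reasoning
        c = lookup N w
        #A′≡k : # (insertAt A′ w false) ≡ k
        #A′≡k = trans (#-insertAt A′ w false) (ℕ.suc-injective (trans (sym (#-insertAt A′ w true)) #A≡1+k))

-- The polynomial M̄ as a product

module _ {k} (rk m : Subset k → ℕ) where

  𝓑-entries : All.All (λ p → IsBasis rk m (proj₁ p) × proj₁ p ⊆ proj₂ p) (𝓑 rk m)
  𝓑-entries = concat⁺ (map⁺ (All.map (λ isB →
    concat⁺ (map⁺ (All.map (λ B⊆T → replicate⁺ _ (isB , B⊆T)) (all-filter (_ ⊆?_) (allSubsets k)))))
    (all-filter (isBasis? rk m) (allSubsets k))))

  𝓑*-entries : All.All (λ p → Σ (Subset k) λ B → IsBasis rk m B × proj₁ p ≡ ∁ B × ∁ B ⊆ proj₂ p) (𝓑* rk m)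
  𝓑*-entries = concat⁺ (map⁺ (All.map (λ isB →
    concat⁺ (map⁺ (All.map (λ B⊆T → replicate⁺ _ (_ , isB , refl , B⊆T)) (all-filter (_ ⊆?_) (allSubsets k)))))
    (all-filter (isBasis? rk m) (allSubsets k))))

activitySum : ∀ {k} (rk m : Subset k → ℕ) → Subset k → ℤ → ℤ
activitySum rk m B y = ∑⊇ B (λ T → + ∣ μ rk m T ∣ * y ^ # (T ─ B))

dualActivitySum : ∀ {k} (rk m : Subset k → ℕ) → Subset k → ℤ → ℤ
dualActivitySum rk m B x = ∑⊇ (∁ B) (λ T̃ → + ∣ μ* rk m T̃ ∣ * x ^ # (T̃ ─ ∁ B))

module _ {k} {rk m : Subset k → ℕ} {N : Subset k} (rk≗ : ColoopRank rk N) (Ψ : EquiBij rk m) (x y : ℤ) where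
  open EquiBij Ψ

  private
    L = length (𝓑 rk m)

    a b : Fin L → Subset k × Subset k
    a i = List.lookup (𝓑 rk m) i
    b i = List.lookup (𝓑* rk m) (Inverse.to ψ i)

    a-shape : ∀ i → proj₁ (a i) ≡ N × N ⊆ proj₂ (a i)
    a-shape i with All.lookup (𝓑-entries rk m) (∈-lookup i)
    ... | isB , B⊆T = B≡N , subst (_⊆ proj₂ (a i)) B≡N B⊆T
      where B≡N = ColoopRank-basis-unique rk≗ m isB

    b-shape : ∀ i → proj₁ (b i) ≡ ∁ N × ∁ N ⊆ proj₂ (b i)
    b-shape i with All.lookup (𝓑*-entries rk m) (∈-lookup (Inverse.to ψ i))
    ... | B , isB , Bᶜ≡∁B , ∁B⊆T̃ = trans Bᶜ≡∁B (cong ∁ B≡N) , subst (λ B → ∁ B ⊆ proj₂ (b i)) B≡N ∁B⊆T̃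
      where B≡N = ColoopRank-basis-unique rk≗ m isB

    P? : ∀ T T̃ i → Dec (a i ≡ (N , T) × b i ≡ (∁ N , T̃))
    P? T T̃ i = (_≟ₚ_ rk m (a i) (N , T)) ×-dec (_≟ₚ_ rk m (b i) (∁ N , T̃))

    P⇒≡ : ∀ {T T̃ i} → a i ≡ (N , T) × b i ≡ (∁ N , T̃) → T ≡ proj₂ (a i) × T̃ ≡ proj₂ (b i)
    P⇒≡ (aᵢ≡ , bᵢ≡) = sym (cong proj₂ aᵢ≡) , sym (cong proj₂ bᵢ≡)

    P-refl : ∀ i → a i ≡ (N , proj₂ (a i)) × b i ≡ (∁ N , proj₂ (b i))
    P-refl i = cong (_, proj₂ (a i)) (proj₁ (a-shape i)) , cong (_, proj₂ (b i)) (proj₁ (b-shape i))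

    H : Subset k → Subset k → ℤ
    H T T̃ = x ^ # (T̃ ─ ∁ N) * y ^ # (T ─ N)

    fibreSize : Subset k → Subset k → ℕ
    fibreSize T T̃ = count (P? T T̃) (allFin L)

    Mbar-over-𝓑 : Mbar rk m Ψ x y ≡ sumℤ (map (λ i → H (proj₂ (a i)) (proj₂ (b i))) (allFin L))
    Mbar-over-𝓑 = begin
      Mbar rk m Ψ x y
        ≡⟨ sumℤ-allFin _ F ⟩
      ℤSum.sum F
        ≡⟨ ℤSum.sum-permute F ψ ⟩
      ℤSum.sum (λ i → F (Inverse.to ψ i))
        ≡⟨ ℤSum.sum-cong-≗ summand ⟩
      ℤSum.sum (λ i → H (proj₂ (a i)) (proj₂ (b i)))
        ≡⟨ sumℤ-allFin L _ ⟨
      sumℤ (map (λ i → H (proj₂ (a i)) (proj₂ (b i))) (allFin L)) ∎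
      where
      open ≡-Reasoning
      F = λ j → x ^ e rk m (List.lookup (𝓑* rk m) j) * y ^ e rk m (List.lookup (𝓑 rk m) (Inverse.from ψ j))
      summand : ∀ i → F (Inverse.to ψ i) ≡ H (proj₂ (a i)) (proj₂ (b i))
      summand i = trans
        (cong (λ j → x ^ e rk m (b i) * y ^ e rk m (List.lookup (𝓑 rk m) j)) (Inverse.strictlyInverseʳ ψ i))
        (cong₂ (λ Bᶜ B → x ^ # (proj₂ (b i) ─ Bᶜ) * y ^ # (proj₂ (a i) ─ B)) (proj₁ (b-shape i)) (proj₁ (a-shape i)))

    activity-term : Subset k → ℤ
    activity-term T = if does (N ⊆? T) then + ∣ μ rk m T ∣ * y ^ # (T ─ N) else + 0

    dualActivity-term : Subset k → ℤ
    dualActivity-term T̃ = if does (∁ N ⊆? T̃) then + ∣ μ* rk m T̃ ∣ * x ^ # (T̃ ─ ∁ N) else + 0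

    no-fibre : ∀ {T T̃} → (∀ i → ¬ (T ≡ proj₂ (a i) × T̃ ≡ proj₂ (b i))) → + fibreSize T T̃ * H T T̃ ≡ + 0
    no-fibre {T} {T̃} ¬fibre =
      trans (cong (λ c → + c * H T T̃) (count-none (P? T T̃) (allFin L) (λ i p → ¬fibre i (P⇒≡ p))))
            (ℤ.*-zeroˡ (H T T̃))

    weighted-count : ∀ T T̃ → + m N * (+ fibreSize T T̃ * H T T̃) ≡ activity-term T * dualActivity-term T̃
    weighted-count T T̃ with N ⊆? T | ∁ N ⊆? T̃
    ... | yes N⊆T | yes ∁N⊆T̃ = rearrange (+ m N) (+ fibreSize T T̃) (+ ∣ μ rk m T ∣) (+ ∣ μ* rk m T̃ ∣) (x ^ # (T̃ ─ ∁ N)) (y ^ # (T ─ N))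
      (trans (sym (ℤ.pos-* (fibreSize T T̃) (m N)))
        (trans (cong +_ (equid N T T̃ (ColoopRank-IsBasis rk≗ m) N⊆T ∁N⊆T̃)) (ℤ.pos-* ∣ μ rk m T ∣ ∣ μ* rk m T̃ ∣)))
      where
      rearrange : ∀ (mN c u w X Y : ℤ) → c * mN ≡ u * w → mN * (c * (X * Y)) ≡ (u * Y) * (w * X)
      rearrange mN c u w X Y c·mN≡u·w = trans (reassoc mN c X Y) (trans (cong (_* (X * Y)) c·mN≡u·w) (swap u w X Y))
        where
        reassoc : ∀ (mN c X Y : ℤ) → mN * (c * (X * Y)) ≡ (c * mN) * (X * Y)
        reassoc = solve-∀
        swap : ∀ (u w X Y : ℤ) → (u * w) * (X * Y) ≡ (u * Y) * (w * X)
        swap = solve-∀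
    ... | no N⊈T | _ = trans (cong (+ m N *_) (no-fibre (λ i (T≡ , _) → N⊈T (subst (N ⊆_) (sym T≡) (proj₂ (a-shape i))))))
                             (ℤ.*-zeroʳ (+ m N))
    ... | yes _ | no ∁N⊈T̃ =
      trans (cong (+ m N *_) (no-fibre (λ i (_ , T̃≡) → ∁N⊈T̃ (subst (∁ N ⊆_) (sym T̃≡) (proj₂ (b-shape i))))))
            (trans (ℤ.*-zeroʳ (+ m N)) (sym (ℤ.*-zeroʳ (+ ∣ μ rk m T ∣ * y ^ # (T ─ N)))))

  -- By equidistribution the fibre over (T , T̃) has m(N)⁻¹ |μ(T)| |μ*(T̃)| elements.
  Mbar-factorisation : + m N * Mbar rk m Ψ x y ≡ activitySum rk m N y * dualActivitySum rk m N x
  Mbar-factorisation = begin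
    + m N * Mbar rk m Ψ x y
      ≡⟨ cong (+ m N *_) (trans Mbar-over-𝓑 (sumℤ-by-fibres (λ i → proj₂ (a i)) (λ i → proj₂ (b i)) P? P⇒≡ P-refl H (allFin L))) ⟩
    + m N * ∑ k (λ T → ∑ k (λ T̃ → + fibreSize T T̃ * H T T̃))
      ≡⟨ *-distribˡ-∑ k (+ m N) _ ⟨
    ∑ k (λ T → + m N * ∑ k (λ T̃ → + fibreSize T T̃ * H T T̃))
      ≡⟨ ∑-cong k (λ T → *-distribˡ-∑ k (+ m N) _) ⟨
    ∑ k (λ T → ∑ k (λ T̃ → + m N * (+ fibreSize T T̃ * H T T̃)))
      ≡⟨ ∑-cong k (λ T → ∑-cong k (weighted-count T)) ⟩
    ∑ k (λ T → ∑ k (λ T̃ → activity-term T * dualActivity-term T̃))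
      ≡⟨ ∑-*-∑ k k activity-term dualActivity-term ⟩
    activitySum rk m N y * dualActivitySum rk m N x ∎
    where open ≡-Reasoning

-- Deletion and contraction

sgn-suc-∸ : ∀ {a b} → a ≤ b → sgn (suc b ∸ a) ≡ - sgn (b ∸ a)
sgn-suc-∸ a≤b = cong sgn (ℕ.+-∸-assoc 1 a≤b)

module _ {n} (rk m : Subset (suc n) → ℕ) (v : Fin (suc n)) (A : Subset n) where

  μ-insertAt-inside : μ rk m (insertAt A v true) ≡ μ (conRk rk v) (conM m v) A
  μ-insertAt-inside = begin
    μ rk m (insertAt A v true)
      ≡⟨ intervalSum-⊤ (insertAt A v true) _ ⟩
    ∑⊇ (insertAt A v true) (λ T → sgn (# T ∸ # (insertAt A v true)) * + m T)
      ≡⟨ ∑⊇-insertAt-inside A v (λ T → sgn (# T ∸ # (insertAt A v true)) * + m T) ⟩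
    ∑⊇ A (λ T → sgn (# (insertAt T v true) ∸ # (insertAt A v true)) * + m (insertAt T v true))
      ≡⟨ ∑⊇-cong A (λ T _ → cong (λ d → sgn d * + m (insertAt T v true))
                                 (cong₂ _∸_ (#-insertAt T v true) (#-insertAt A v true))) ⟩
    ∑⊇ A (λ T → sgn (# T ∸ # A) * + conM m v T)
      ≡⟨ intervalSum-⊤ A _ ⟨
    μ (conRk rk v) (conM m v) A ∎
    where open ≡-Reasoning

  μ*-insertAt-inside : μ* rk m (insertAt A v true) ≡ μ* (delRk rk v) (delM m v) A
  μ*-insertAt-inside = begin
    μ* rk m (insertAt A v true)
      ≡⟨ intervalSum-⊤ (insertAt A v true) _ ⟩
    ∑⊇ (insertAt A v true) (λ T → sgn (# T ∸ # (insertAt A v true)) * + m (∁ T))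
      ≡⟨ ∑⊇-insertAt-inside A v (λ T → sgn (# T ∸ # (insertAt A v true)) * + m (∁ T)) ⟩
    ∑⊇ A (λ T → sgn (# (insertAt T v true) ∸ # (insertAt A v true)) * + m (∁ (insertAt T v true)))
      ≡⟨ ∑⊇-cong A (λ T _ → cong₂ (λ d B → sgn d * + m B)
                                  (cong₂ _∸_ (#-insertAt T v true) (#-insertAt A v true))
                                  (map-insertAt not true T v)) ⟩
    ∑⊇ A (λ T → sgn (# T ∸ # A) * + delM m v (∁ T))
      ≡⟨ intervalSum-⊤ A _ ⟨
    μ* (delRk rk v) (delM m v) A ∎
    where open ≡-Reasoning

  μ*-insertAt-outside : μ* rk m (insertAt A v false) ≡ μ* (conRk rk v) (conM m v) A - μ* (delRk rk v) (delM m v) A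
  μ*-insertAt-outside = begin
    μ* rk m (insertAt A v false)
      ≡⟨ intervalSum-⊤ (insertAt A v false) _ ⟩
    ∑⊇ (insertAt A v false) (λ T → sgn (# T ∸ # (insertAt A v false)) * + m (∁ T))
      ≡⟨ ∑⊇-insertAt-outside A v (λ T → sgn (# T ∸ # (insertAt A v false)) * + m (∁ T)) ⟩
    ∑⊇ A (λ T → sgn (# (insertAt T v false) ∸ # (insertAt A v false)) * + m (∁ (insertAt T v false)))
      + ∑⊇ A (λ T → sgn (# (insertAt T v true) ∸ # (insertAt A v false)) * + m (∁ (insertAt T v true)))
      ≡⟨ cong₂ _+_ (∑⊇-cong A (λ T _ → cong₂ (λ d B → sgn d * + m B)
                                             (cong₂ _∸_ (#-insertAt T v false) (#-insertAt A v false))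
                                             (map-insertAt not false T v)))
                   (∑⊇-cong A (λ T A⊆T → trans (cong₂ (λ d B → sgn d * + m B)
                                                     (cong₂ _∸_ (#-insertAt T v true) (#-insertAt A v false))
                                                     (map-insertAt not true T v))
                                              (alternate T A⊆T))) ⟩
    ∑⊇ A (λ T → sgn (# T ∸ # A) * + conM m v (∁ T)) + ∑⊇ A (λ T → - (sgn (# T ∸ # A) * + delM m v (∁ T)))
      ≡⟨ cong (λ s → ∑⊇ A (λ T → sgn (# T ∸ # A) * + conM m v (∁ T)) + s) (neg-∑⊇ _) ⟩
    ∑⊇ A (λ T → sgn (# T ∸ # A) * + conM m v (∁ T)) - ∑⊇ A (λ T → sgn (# T ∸ # A) * + delM m v (∁ T))
      ≡⟨ cong₂ _-_ (intervalSum-⊤ A _) (intervalSum-⊤ A _) ⟨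
    μ* (conRk rk v) (conM m v) A - μ* (delRk rk v) (delM m v) A ∎
    where
    open ≡-Reasoning
    alternate : ∀ T → A ⊆ T → sgn (suc (# T) ∸ # A) * + delM m v (∁ T) ≡ - (sgn (# T ∸ # A) * + delM m v (∁ T))
    alternate T A⊆T = trans (cong (_* + delM m v (∁ T)) (sgn-suc-∸ (p⊆q⇒∣p∣≤∣q∣ A⊆T)))
                            (sym (ℤ.neg-distribˡ-* (sgn (# T ∸ # A)) _))
    neg-∑⊇ : ∀ f → ∑⊇ A (λ T → - f T) ≡ - ∑⊇ A f
    neg-∑⊇ f = trans (∑⊇-cong A (λ T _ → sym (ℤ.-1*i≡-i (f T))))
                     (trans (*-distribˡ-∑⊇ A (- + 1) f) (ℤ.-1*i≡-i _))

module _ {n} (M : ArithMatroid (suc n)) {N₁ : Subset n} {v : Fin (suc n)}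
         (rk≗ : ColoopRank (ArithMatroid.rk M) (insertAt N₁ v true)) where
  open ArithMatroid M

  private
    N = insertAt N₁ v true

    rk-insertAt-⊇ : ∀ C c → N₁ ⊆ C → rk (insertAt C v c) ≡ boolToℕ (c ∧ true) ℕ.+ # N₁
    rk-insertAt-⊇ C c N₁⊆C =
      trans (rk≗ _) (trans (#-insertAt-∩ C N₁ v c true) (cong (λ A → boolToℕ (c ∧ true) ℕ.+ # A) (p⊆q⇒q∩p≡p N₁⊆C)))

  -- Axiom (3) with A = N ∖ {v}, F = {v} and T = U ∖ N: adding v raises the rank of every
  -- set between N ∖ {v} and U ∪ {v} by one.
  m-exchange : ∀ U → N₁ ⊆ U →
    m (insertAt N₁ v false) ℕ.* m (insertAt U v true) ≡ m (insertAt N₁ v true) ℕ.* m (insertAt U v false)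
  m-exchange U N₁⊆U = begin
    m A ℕ.* m (insertAt U v true)      ≡⟨ cong (λ B → m A ℕ.* m B) A∪F∪T≡ ⟨
    m A ℕ.* m ((A ∪ F) ∪ T)            ≡⟨ ax3 A F T A∩F≡⊥ A∩T≡⊥ F∩T≡⊥ rank-condition ⟩
    m (A ∪ F) ℕ.* m (A ∪ T)            ≡⟨ cong₂ (λ B C → m B ℕ.* m C) A∪F≡ A∪T≡ ⟩
    m N ℕ.* m (insertAt U v false)     ∎
    where
    open ≡-Reasoning
    A = insertAt N₁ v false
    F = insertAt ⊥ v true
    T = insertAt (U ─ N₁) v false
    A∪F≡ : A ∪ F ≡ N
    A∪F≡ = trans (insertAt-zipWith _∨_ N₁ ⊥ v false true) (cong (λ B → insertAt B v true) (∪-identityʳ N₁))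
    A∪F∪T≡ : (A ∪ F) ∪ T ≡ insertAt U v true
    A∪F∪T≡ = trans (cong (_∪ T) A∪F≡)
      (trans (insertAt-zipWith _∨_ N₁ (U ─ N₁) v true false) (cong (λ B → insertAt B v true) (p⊆q⇒p∪[q─p]≡q N₁⊆U)))
    A∪T≡ : A ∪ T ≡ insertAt U v false
    A∪T≡ = trans (insertAt-zipWith _∨_ N₁ (U ─ N₁) v false false) (cong (λ B → insertAt B v false) (p⊆q⇒p∪[q─p]≡q N₁⊆U))
    A∩F≡⊥ : A ∩ F ≡ ⊥
    A∩F≡⊥ = trans (insertAt-zipWith _∧_ N₁ ⊥ v false true)
      (trans (cong (λ B → insertAt B v false) (∩-zeroʳ N₁)) (sym (replicate-insertAt false v)))
    A∩T≡⊥ : A ∩ T ≡ ⊥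
    A∩T≡⊥ = trans (insertAt-zipWith _∧_ N₁ (U ─ N₁) v false false)
      (trans (cong (λ B → insertAt B v false) (p∩[q─p]≡⊥ N₁ U)) (sym (replicate-insertAt false v)))
    F∩T≡⊥ : F ∩ T ≡ ⊥
    F∩T≡⊥ = trans (insertAt-zipWith _∧_ ⊥ (U ─ N₁) v true false)
      (trans (cong (λ B → insertAt B v false) (∩-zeroˡ (U ─ N₁))) (sym (replicate-insertAt false v)))
    rank-condition-insertAt : ∀ C c → A ⊆ insertAt C v c → rk (insertAt C v c) ≡ rk A ℕ.+ # (insertAt C v c ∩ F)
    rank-condition-insertAt C c A⊆C = begin
      rk (insertAt C v c)                            ≡⟨ rk-insertAt-⊇ C c (insertAt-⊆⁻ v c A⊆C) ⟩
      boolToℕ (c ∧ true) ℕ.+ # N₁                    ≡⟨ ℕ.+-comm (boolToℕ (c ∧ true)) (# N₁) ⟩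
      # N₁ ℕ.+ boolToℕ (c ∧ true)                    ≡⟨ cong₂ ℕ._+_ (rk-insertAt-⊇ N₁ false (λ x∈N₁ → x∈N₁)) (ℕ.+-identityʳ _) ⟨
      rk A ℕ.+ (boolToℕ (c ∧ true) ℕ.+ 0)            ≡⟨ cong (λ k → rk A ℕ.+ (boolToℕ (c ∧ true) ℕ.+ k))
                                                           (trans (cong #_ (∩-zeroʳ C)) (∣⊥∣≡0 n)) ⟨
      rk A ℕ.+ (boolToℕ (c ∧ true) ℕ.+ # (C ∩ ⊥))    ≡⟨ cong (rk A ℕ.+_) (#-insertAt-∩ C ⊥ v c true) ⟨
      rk A ℕ.+ # (insertAt C v c ∩ F)                ∎
    rank-condition : ∀ C → A ⊆ C → C ⊆ (A ∪ F) ∪ T → rk C ≡ rk A ℕ.+ # (C ∩ F)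
    rank-condition C A⊆C _ rewrite sym (insertAt-removeAt C v) =
      rank-condition-insertAt (removeAt C v) (lookup C v) A⊆C

module _ {n} (M : ArithMatroid n) {N : Subset n} (rk≗ : ColoopRank (ArithMatroid.rk M) N) where
  open ArithMatroid M

  -- Every T̃ ⊇ X ∖ N has full dual rank, so axiom (5) applies to the interval [T̃ , X].
  ColoopRank⇒μ*-nonneg : ∀ T̃ → ∁ N ⊆ T̃ → + 0 ℤ.≤ μ* rk m T̃
  ColoopRank⇒μ*-nonneg T̃ ∁N⊆T̃ = ax5 T̃ ⊤ ⊆⊤ (trans dualRank-T̃ (sym dualRank-⊤))
    where
    move : ∀ (a r b : ℤ) → (a - r) + b ≡ (a + b) - r
    move = solve-∀
    ∁T̃⊆N : ∁ T̃ ⊆ N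
    ∁T̃⊆N x∈∁T̃ = x∉∁p⇒x∈p (λ x∈∁N → x∈∁p⇒x∉p x∈∁T̃ (∁N⊆T̃ x∈∁N))
    dualRank-T̃ : dualRank rk T̃ ≡ + n - + rk ⊤
    dualRank-T̃ = begin
      (+ # T̃ - + rk ⊤) + + rk (∁ T̃)   ≡⟨ cong (λ k → (+ # T̃ - + rk ⊤) + + k) (trans (rk≗ (∁ T̃)) (cong #_ (trans (∩-comm (∁ T̃) N) (p⊆q⇒q∩p≡p ∁T̃⊆N)))) ⟩
      (+ # T̃ - + rk ⊤) + + # (∁ T̃)    ≡⟨ move (+ # T̃) (+ rk ⊤) (+ # (∁ T̃)) ⟩
      (+ # T̃ + + # (∁ T̃)) - + rk ⊤    ≡⟨ cong (_- + rk ⊤) (ℤ.pos-+ (# T̃) (# (∁ T̃))) ⟨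
      + (# T̃ ℕ.+ # (∁ T̃)) - + rk ⊤    ≡⟨ cong (λ k → + k - + rk ⊤) (trans (cong (# T̃ ℕ.+_) (∣∁p∣≡n∸∣p∣ T̃)) (ℕ.m+[n∸m]≡n (∣p∣≤n T̃))) ⟩
      + n - + rk ⊤                     ∎
      where open ≡-Reasoning
    dualRank-⊤ : dualRank rk ⊤ ≡ + n - + rk ⊤
    dualRank-⊤ = begin
      (+ # (⊤ {n}) - + rk ⊤) + + rk (∁ ⊤) ≡⟨ cong₂ (λ k l → (+ k - + rk ⊤) + + l) (∣⊤∣≡n n) rk∁⊤≡0 ⟩
      (+ n - + rk ⊤) + + 0                ≡⟨ ℤ.+-identityʳ _ ⟩
      + n - + rk ⊤                        ∎
      where
      open ≡-Reasoning
      rk∁⊤≡0 : rk (∁ ⊤) ≡ 0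
      rk∁⊤≡0 = trans (rk≗ (∁ ⊤)) (trans (cong (λ A → # (A ∩ N)) (map-replicate not true n))
                                        (trans (cong #_ (∩-zeroˡ N)) (∣⊥∣≡0 n)))

activitySum-contraction : ∀ {n} (rk m : Subset (suc n) → ℕ) (v : Fin (suc n)) N₁ y →
  activitySum rk m (insertAt N₁ v true) y ≡ activitySum (conRk rk v) (conM m v) N₁ y
activitySum-contraction rk m v N₁ y =
  trans (∑⊇-insertAt-inside N₁ v (λ T → + ∣ μ rk m T ∣ * y ^ # (T ─ insertAt N₁ v true)))
        (∑⊇-cong N₁ (λ T _ → cong₂ (λ μT k → + ∣ μT ∣ * y ^ k)
                                   (μ-insertAt-inside rk m v T) (#-insertAt-─-inside T N₁ v true)))

module _ {n} (M : ArithMatroid (suc n)) {N₁ : Subset n} {v : Fin (suc n)}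
         (rk≗ : ColoopRank (ArithMatroid.rk M) (insertAt N₁ v true)) where
  open ArithMatroid M

  private
    c₁ c : ℕ
    c₁ = m (insertAt N₁ v false)
    c  = m (insertAt N₁ v true)

  μ-exchange : ∀ A → N₁ ⊆ A → + c₁ * μ (conRk rk v) (conM m v) A ≡ + c * μ (delRk rk v) (delM m v) A
  μ-exchange A N₁⊆A = begin
    + c₁ * μ (conRk rk v) (conM m v) A
      ≡⟨ cong (+ c₁ *_) (intervalSum-⊤ A _) ⟩
    + c₁ * ∑⊇ A (λ T → s T * + m (insertAt T v true))
      ≡⟨ *-distribˡ-∑⊇ A (+ c₁) _ ⟨
    ∑⊇ A (λ T → + c₁ * (s T * + m (insertAt T v true)))
      ≡⟨ ∑⊇-cong A (λ T A⊆T → exchange T (⊆-trans N₁⊆A A⊆T)) ⟩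
    ∑⊇ A (λ T → + c * (s T * + m (insertAt T v false)))
      ≡⟨ *-distribˡ-∑⊇ A (+ c) _ ⟩
    + c * ∑⊇ A (λ T → s T * + m (insertAt T v false))
      ≡⟨ cong (+ c *_) (intervalSum-⊤ A _) ⟨
    + c * μ (delRk rk v) (delM m v) A ∎
    where
    open ≡-Reasoning
    s : Subset n → ℤ
    s T = sgn (# T ∸ # A)
    commute : ∀ (a σ b : ℤ) → a * (σ * b) ≡ σ * (a * b)
    commute = solve-∀
    exchange : ∀ T → N₁ ⊆ T → + c₁ * (s T * + m (insertAt T v true)) ≡ + c * (s T * + m (insertAt T v false))
    exchange T N₁⊆T = begin
      + c₁ * (s T * + m (insertAt T v true))     ≡⟨ commute (+ c₁) (s T) _ ⟩
      s T * (+ c₁ * + m (insertAt T v true))     ≡⟨ cong (s T *_) (ℤ.pos-* c₁ _) ⟨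
      s T * + (c₁ ℕ.* m (insertAt T v true))     ≡⟨ cong (λ k → s T * + k) (m-exchange M rk≗ T N₁⊆T) ⟩
      s T * + (c ℕ.* m (insertAt T v false))     ≡⟨ cong (s T *_) (ℤ.pos-* c _) ⟩
      s T * (+ c * + m (insertAt T v false))     ≡⟨ commute (+ c) (s T) _ ⟨
      + c * (s T * + m (insertAt T v false))     ∎

  activitySum-deletion : ∀ y →
    + c₁ * activitySum (conRk rk v) (conM m v) N₁ y ≡ + c * activitySum (delRk rk v) (delM m v) N₁ y
  activitySum-deletion y = begin
    + c₁ * ∑⊇ N₁ (λ T → + ∣ μcon T ∣ * Y T)    ≡⟨ *-distribˡ-∑⊇ N₁ (+ c₁) _ ⟨
    ∑⊇ N₁ (λ T → + c₁ * (+ ∣ μcon T ∣ * Y T))  ≡⟨ ∑⊇-cong N₁ scaled ⟩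
    ∑⊇ N₁ (λ T → + c * (+ ∣ μdel T ∣ * Y T))   ≡⟨ *-distribˡ-∑⊇ N₁ (+ c) _ ⟩
    + c * ∑⊇ N₁ (λ T → + ∣ μdel T ∣ * Y T)     ∎
    where
    open ≡-Reasoning
    μcon μdel : Subset n → ℤ
    μcon = μ (conRk rk v) (conM m v)
    μdel = μ (delRk rk v) (delM m v)
    Y : Subset n → ℤ
    Y T = y ^ # (T ─ N₁)
    scaled : ∀ T → N₁ ⊆ T → + c₁ * (+ ∣ μcon T ∣ * Y T) ≡ + c * (+ ∣ μdel T ∣ * Y T)
    scaled T N₁⊆T = begin
      + c₁ * (+ ∣ μcon T ∣ * Y T)        ≡⟨ ℤ.*-assoc (+ c₁) (+ ∣ μcon T ∣) (Y T) ⟨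
      + c₁ * + ∣ μcon T ∣ * Y T          ≡⟨ cong (_* Y T) (ℤ.pos-* c₁ ∣ μcon T ∣) ⟨
      + (c₁ ℕ.* ∣ μcon T ∣) * Y T        ≡⟨ cong (λ k → + k * Y T) (ℤ.abs-* (+ c₁) (μcon T)) ⟨
      + ∣ + c₁ * μcon T ∣ * Y T          ≡⟨ cong (λ k → + ∣ k ∣ * Y T) (μ-exchange T N₁⊆T) ⟩
      + ∣ + c * μdel T ∣ * Y T           ≡⟨ cong (λ k → + k * Y T) (ℤ.abs-* (+ c) (μdel T)) ⟩
      + (c ℕ.* ∣ μdel T ∣) * Y T         ≡⟨ cong (_* Y T) (ℤ.pos-* c ∣ μdel T ∣) ⟩
      + c * + ∣ μdel T ∣ * Y T           ≡⟨ ℤ.*-assoc (+ c) (+ ∣ μdel T ∣) (Y T) ⟩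
      + c * (+ ∣ μdel T ∣ * Y T)         ∎

  private
    ∁N≡ : ∁ (insertAt N₁ v true) ≡ insertAt (∁ N₁) v false
    ∁N≡ = map-insertAt not true N₁ v

  μ*-insertAt-nonneg : ∀ T b → ∁ N₁ ⊆ T → + 0 ℤ.≤ μ* rk m (insertAt T v b)
  μ*-insertAt-nonneg T b ∁N₁⊆T =
    ColoopRank⇒μ*-nonneg M rk≗ _ (subst (_⊆ insertAt T v b) (sym ∁N≡) (insertAt-⊆⁺ v b ∁N₁⊆T))

  ∣μ*-deletion∣ : ∀ T → ∁ N₁ ⊆ T → + ∣ μ* (delRk rk v) (delM m v) T ∣ ≡ μ* rk m (insertAt T v true)
  ∣μ*-deletion∣ T ∁N₁⊆T = trans (cong (λ z → + ∣ z ∣) (sym (μ*-insertAt-inside rk m v T)))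
                                (ℤ.0≤i⇒+∣i∣≡i (μ*-insertAt-nonneg T true ∁N₁⊆T))

  ∣μ*-contraction∣ : ∀ T → ∁ N₁ ⊆ T →
    + ∣ μ* (conRk rk v) (conM m v) T ∣ ≡ μ* rk m (insertAt T v false) + μ* rk m (insertAt T v true)
  ∣μ*-contraction∣ T ∁N₁⊆T = trans (cong (λ z → + ∣ z ∣) μ*con≡) (ℤ.0≤i⇒+∣i∣≡i
    (ℤ.+-mono-≤ (μ*-insertAt-nonneg T false ∁N₁⊆T) (μ*-insertAt-nonneg T true ∁N₁⊆T)))
    where
    undo : ∀ (a b : ℤ) → a ≡ (a - b) + b
    undo = solve-∀
    μ*con≡ : μ* (conRk rk v) (conM m v) T ≡ μ* rk m (insertAt T v false) + μ* rk m (insertAt T v true)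
    μ*con≡ = trans (undo _ (μ* (delRk rk v) (delM m v) T))
                   (cong₂ _+_ (sym (μ*-insertAt-outside rk m v T)) (sym (μ*-insertAt-inside rk m v T)))

  dualActivity-summands : ∀ x T → ∁ N₁ ⊆ T →
      + ∣ μ* rk m (insertAt T v false) ∣ * x ^ # (insertAt T v false ─ insertAt (∁ N₁) v false)
    + + ∣ μ* rk m (insertAt T v true) ∣ * x ^ # (insertAt T v true ─ insertAt (∁ N₁) v false)
    ≡ + ∣ μ* (conRk rk v) (conM m v) T ∣ * x ^ # (T ─ ∁ N₁)
      + (x - + 1) * (+ ∣ μ* (delRk rk v) (delM m v) T ∣ * x ^ # (T ─ ∁ N₁))
  dualActivity-summands x T ∁N₁⊆T = begin
    + ∣ P ∣ * x ^ # (insertAt T v false ─ insertAt (∁ N₁) v false)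
      + + ∣ Q ∣ * x ^ # (insertAt T v true ─ insertAt (∁ N₁) v false)
      ≡⟨ cong₂ (λ k l → + ∣ P ∣ * x ^ k + + ∣ Q ∣ * x ^ l)
               (#-insertAt-─-outside T (∁ N₁) v false) (#-insertAt-─-outside T (∁ N₁) v true) ⟩
    + ∣ P ∣ * X + + ∣ Q ∣ * (x * X)
      ≡⟨ cong₂ (λ p q → p * X + q * (x * X)) (ℤ.0≤i⇒+∣i∣≡i (μ*-insertAt-nonneg T false ∁N₁⊆T))
                                             (ℤ.0≤i⇒+∣i∣≡i (μ*-insertAt-nonneg T true ∁N₁⊆T)) ⟩
    P * X + Q * (x * X)
      ≡⟨ regroup P Q x X ⟩
    (P + Q) * X + (x - + 1) * (Q * X)
      ≡⟨ cong₂ (λ p q → p * X + (x - + 1) * (q * X)) (∣μ*-contraction∣ T ∁N₁⊆T) (∣μ*-deletion∣ T ∁N₁⊆T) ⟨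
    + ∣ μ* (conRk rk v) (conM m v) T ∣ * X + (x - + 1) * (+ ∣ μ* (delRk rk v) (delM m v) T ∣ * X) ∎
    where
    open ≡-Reasoning
    P = μ* rk m (insertAt T v false)
    Q = μ* rk m (insertAt T v true)
    X = x ^ # (T ─ ∁ N₁)
    regroup : ∀ (P Q x X : ℤ) → P * X + Q * (x * X) ≡ (P + Q) * X + (x - + 1) * (Q * X)
    regroup = solve-∀

  dualActivitySum-deletion-contraction : ∀ x →
    dualActivitySum rk m (insertAt N₁ v true) x
      ≡ dualActivitySum (conRk rk v) (conM m v) N₁ x + (x - + 1) * dualActivitySum (delRk rk v) (delM m v) N₁ x
  dualActivitySum-deletion-contraction x = begin
    dualActivitySum rk m (insertAt N₁ v true) x
      ≡⟨ cong (λ B → ∑⊇ B (g B)) ∁N≡ ⟩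
    ∑⊇ (insertAt (∁ N₁) v false) (g (insertAt (∁ N₁) v false))
      ≡⟨ ∑⊇-insertAt-outside (∁ N₁) v (g (insertAt (∁ N₁) v false)) ⟩
    ∑⊇ (∁ N₁) (λ T → g (insertAt (∁ N₁) v false) (insertAt T v false))
      + ∑⊇ (∁ N₁) (λ T → g (insertAt (∁ N₁) v false) (insertAt T v true))
      ≡⟨ ∑⊇-+ (∁ N₁) _ _ ⟨
    ∑⊇ (∁ N₁) (λ T → g (insertAt (∁ N₁) v false) (insertAt T v false) + g (insertAt (∁ N₁) v false) (insertAt T v true))
      ≡⟨ ∑⊇-cong (∁ N₁) (dualActivity-summands x) ⟩
    ∑⊇ (∁ N₁) (λ T → hcon T + (x - + 1) * hdel T)
      ≡⟨ ∑⊇-+ (∁ N₁) _ _ ⟩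
    ∑⊇ (∁ N₁) hcon + ∑⊇ (∁ N₁) (λ T → (x - + 1) * hdel T)
      ≡⟨ cong (λ s → ∑⊇ (∁ N₁) hcon + s) (*-distribˡ-∑⊇ (∁ N₁) (x - + 1) hdel) ⟩
    ∑⊇ (∁ N₁) hcon + (x - + 1) * ∑⊇ (∁ N₁) hdel ∎
    where
    open ≡-Reasoning
    g : Subset (suc n) → Subset (suc n) → ℤ
    g B T̃ = + ∣ μ* rk m T̃ ∣ * x ^ # (T̃ ─ B)
    hcon hdel : Subset n → ℤ
    hcon T = + ∣ μ* (conRk rk v) (conM m v) T ∣ * x ^ # (T ─ ∁ N₁)
    hdel T = + ∣ μ* (delRk rk v) (delM m v) T ∣ * x ^ # (T ─ ∁ N₁)

deletion-contraction-identity :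
  ∀ {c c₁ : ℕ} .{{_ : ℕ.NonZero c}} .{{_ : ℕ.NonZero c₁}} {x M₀ M₁ M₂ Y₁ Y₂ Z₁ Z₂ : ℤ} →
  + c * M₀ ≡ Y₂ * (Z₂ + (x - + 1) * Z₁) → + c₁ * M₁ ≡ Y₁ * Z₁ → + c * M₂ ≡ Y₂ * Z₂ →
  + c₁ * Y₂ ≡ + c * Y₁ → M₀ ≡ (x - + 1) * M₁ + M₂
deletion-contraction-identity {c} {c₁} {x} {M₀} {M₁} {M₂} {Y₁} {Y₂} {Z₁} {Z₂} e₀ e₁ e₂ eY =
  ℤ.*-cancelˡ-≡ (+ c) _ _ (ℤ.*-cancelˡ-≡ (+ c₁) _ _ (begin
    + c₁ * (+ c * M₀)                                       ≡⟨ cong (+ c₁ *_) e₀ ⟩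
    + c₁ * (Y₂ * (Z₂ + (x - + 1) * Z₁))                     ≡⟨ expand (+ c₁) Y₂ Z₂ x Z₁ ⟩
    + c₁ * (Y₂ * Z₂) + (x - + 1) * ((+ c₁ * Y₂) * Z₁)       ≡⟨ cong₂ (λ a b → + c₁ * a + (x - + 1) * (b * Z₁)) (sym e₂) eY ⟩
    + c₁ * (+ c * M₂) + (x - + 1) * ((+ c * Y₁) * Z₁)       ≡⟨ cong (λ a → + c₁ * (+ c * M₂) + (x - + 1) * a)
                                                                    (trans (ℤ.*-assoc (+ c) Y₁ Z₁) (cong (+ c *_) (sym e₁))) ⟩
    + c₁ * (+ c * M₂) + (x - + 1) * (+ c * (+ c₁ * M₁))     ≡⟨ collect (+ c) (+ c₁) x M₁ M₂ ⟩
    + c₁ * (+ c * ((x - + 1) * M₁ + M₂))                    ∎))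
  where
  open ≡-Reasoning
  expand : ∀ (c₁ Y₂ Z₂ x Z₁ : ℤ) → c₁ * (Y₂ * (Z₂ + (x - + 1) * Z₁)) ≡ c₁ * (Y₂ * Z₂) + (x - + 1) * ((c₁ * Y₂) * Z₁)
  expand = solve-∀
  collect : ∀ (c c₁ x M₁ M₂ : ℤ) → c₁ * (c * M₂) + (x - + 1) * (c * (c₁ * M₁)) ≡ c₁ * (c * ((x - + 1) * M₁ + M₂))
  collect = solve-∀

mainTheorem9 : ∀ {n : ℕ} (M : ArithMatroid (suc n)) →
    NoProper (ArithMatroid.rk M) →
    (v : Fin (suc n)) → Free (ArithMatroid.rk M) v →
    (Ψ  : EquiBij (ArithMatroid.rk M) (ArithMatroid.m M)) →
    (Ψ₁ : EquiBij (delRk (ArithMatroid.rk M) v) (delM (ArithMatroid.m M) v)) →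
    (Ψ₂ : EquiBij (conRk (ArithMatroid.rk M) v) (conM (ArithMatroid.m M) v)) →
    NoProper (delRk (ArithMatroid.rk M) v) ×
    NoProper (conRk (ArithMatroid.rk M) v) ×
    (∀ (x y : ℤ) →
      Mbar (ArithMatroid.rk M) (ArithMatroid.m M) Ψ x y
        ≡ (x - + 1) * Mbar (delRk (ArithMatroid.rk M) v) (delM (ArithMatroid.m M) v) Ψ₁ x y
          + Mbar (conRk (ArithMatroid.rk M) v) (conM (ArithMatroid.m M) v) Ψ₂ x y)
mainTheorem9 M noProper v free Ψ Ψ₁ Ψ₂ =
  ColoopRank⇒NoProper rk≗₁ , ColoopRank⇒NoProper rk≗₂ , Mbar-deletion-contraction
  where
  open ArithMatroid M
  N₁ = removeAt (coloops rk) v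
  rk≗ : ColoopRank rk (insertAt N₁ v true)
  rk≗ = subst (ColoopRank rk)
    (trans (sym (insertAt-removeAt (coloops rk) v)) (cong (insertAt N₁ v) (Free⇒∈coloops M v free)))
    (NoProper⇒ColoopRank M noProper)
  rk≗₁ = ColoopRank-delRk rk≗
  rk≗₂ = ColoopRank-conRk rk≗
  Mbar-deletion-contraction : ∀ x y →
    Mbar rk m Ψ x y ≡ (x - + 1) * Mbar (delRk rk v) (delM m v) Ψ₁ x y + Mbar (conRk rk v) (conM m v) Ψ₂ x y
  Mbar-deletion-contraction x y =
    deletion-contraction-identity {{ℕ.>-nonZero (m-pos _)}} {{ℕ.>-nonZero (m-pos _)}} {x = x}
      (trans (Mbar-factorisation rk≗ Ψ x y)
             (cong₂ _*_ (activitySum-contraction rk m v N₁ y) (dualActivitySum-deletion-contraction M rk≗ x)))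
      (Mbar-factorisation rk≗₁ Ψ₁ x y)
      (Mbar-factorisation rk≗₂ Ψ₂ x y)
      (activitySum-deletion M rk≗ y)
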